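{- Let $q$ be a prime power and $n,d$ positive integers. Fix polynomials $h_1,\ldots,h_d\in\mathbb{F}_q[x_1,\ldots,x_n]$ of total degree at most $q-1$, and fix vectors $\mathbf{b}_i=(b_{i,1},\ldots,b_{i,n})\in(\mathbb{Z}^+)^n$, $1\le i\le d$, with $\gcd(b_{i,j},q-1)=1$ for all $i,j$. For $\mathbf{a}_i=(a_{i,1},\ldots,a_{i,n+1})\in\mathbb{F}_q^{n+1}$ put $f_{\mathbf{a}_i}(x_1,\ldots,x_n)=\sum_{j=1}^n a_{i,j}x_j^{b_{i,j}}+a_{i,n+1}$, and define the variety $$V_{\mathbf{a}_1,\ldots,\mathbf{a}_d}=\{(x_1,\ldots,x_{n+d})\in\mathbb{F}_q^{n+d}:\ x_{n+i}=h_i(x_1,\ldots,x_n)+f_{\mathbf{a}_i}(x_1,\ldots,x_n)\ \text{for all }1\le i\le d\}.$$ Let $\mathcal{P}$ be a set of points in $\mathbb{F}_q^{n+d}$ and $\mathcal{V}$ a set of varieties of the form $V_{\mathbf{a}_1,\ldots,\mathbf{a}_d}$. Then, if $d\ge 2$, $$\left|I(\mathcal{P},\mathcal{V})-\frac{|\mathcal{P}||\mathcal{V}|}{q^d}\right|\le q^{n/2}\sqrt{|\mathcal{P}||\mathcal{V}|}\left(1+\frac{|\mathcal{V}|}{q}\right)^{1/2},$$ and if $d=1$, $$\left|I(\mathcal{P},\mathcal{V})-\frac{|\mathcal{P}||\mathcal{V}|}{q}\right|\le q^{n/2}\left(1-\frac{1}{q}\right)\sqrt{|\mathcal{P}||\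mathcal{V}|}.$$
   Context: $I(\mathcal{P},\mathcal{V})$ denotes the number of pairs $(\mathbf{p},V)\in\mathcal{P}\times\mathcal{V}$ with $\mathbf{p}\in V$. -}

module Defs where

open import Data.Nat as ℕ using (ℕ; zero; suc)
open import Data.Fin using (Fin; zero; suc; _↑ˡ_; _↑ʳ_; inject₁; fromℕ)
open import Data.Vec using (Vec; []; _∷_; lookup; tabulate)
open import Data.List using (List; []; _∷_; length; foldr; map)
open import Data.Nat.ListAction using (sum)
open import Data.List.Membership.Propositional using (_∈_)
open import Data.List.Relation.Unary.Unique.Propositional using (Unique)
open import Data.Product using (_×_; _,_; ∃)
open import Data.Sum using (_⊎_)
open import Relation.Binary.PropositionalEquality using (_≡_; _≢_)
open import Relation.Binary.Definitions using (DecidableEquality)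
open import Relation.Nullary using (Dec; yes; no; ¬_)
open import Relation.Nullary.Decidable using (isYes)
open import Data.Bool using (if_then_else_)
open import Data.Fin.Properties using (all?)

record FiniteField : Set₁ where
  infixl 6 _+_
  infixl 7 _*_
  field
    Carrier : Set
    _≟_     : DecidableEquality Carrier
    0# 1#   : Carrier
    _+_ _*_ : Carrier → Carrier → Carrier
    -_      : Carrier → Carrier
    +-assoc  : ∀ x y z → (x + y) + z ≡ x + (y + z)
    +-comm   : ∀ x y → x + y ≡ y + x
    +-identityˡ : ∀ x → 0# + x ≡ x
    -‿inverseˡ : ∀ x → (- x) + x ≡ 0#
    *-assoc  : ∀ x y z → (x * y) * z ≡ x * (y * z)
    *-comm   : ∀ x y → x * y ≡ y * x
    *-identityˡ : ∀ x → 1# * x ≡ x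
    distribˡ : ∀ x y z → x * (y + z) ≡ x * y + x * z
    0≢1      : 0# ≢ 1#
    inverse  : ∀ x → x ≢ 0# → ∃ λ y → y * x ≡ 1#
    elements : List Carrier
    elements-unique   : Unique elements
    elements-complete : ∀ x → x ∈ elements

  size : ℕ
  size = length elements

  _^_ : Carrier → ℕ → Carrier
  x ^ zero  = 1#
  x ^ suc k = x * (x ^ k)

  Σ : List Carrier → Carrier
  Σ = foldr _+_ 0#

module _ (F : FiniteField) where
  open FiniteField F

  Poly : ℕ → Set
  Poly n = List (Carrier × (Fin n → ℕ))

  monoDeg : ∀ {n} → (Fin n → ℕ) → ℕ
  monoDeg {zero}  e = 0
  monoDeg {suc n} e = e zero ℕ.+ monoDeg (λ j → e (suc j))

  data DegLe {n : ℕ} (D : ℕ) : Poly n → Set where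
    []  : DegLe D []
    _∷_ : ∀ {c e p} → monoDeg e ℕ.≤ D → DegLe D p → DegLe D ((c , e) ∷ p)

  evalMono : ∀ {n} → (Fin n → ℕ) → Vec Carrier n → Carrier
  evalMono {zero}  e []       = 1#
  evalMono {suc n} e (x ∷ xs) = (x ^ e zero) * evalMono (λ j → e (suc j)) xs

  eval : ∀ {n} → Poly n → Vec Carrier n → Carrier
  eval p x = Σ (map (λ { (c , e) → c * evalMono e x }) p)

  sumFin : ∀ {n} → (Fin n → Carrier) → Carrier
  sumFin {zero}  g = 0#
  sumFin {suc n} g = g zero + sumFin (λ j → g (suc j))

  fA : ∀ {n} → (b : Fin n → ℕ) → Vec Carrier (suc n) → Vec Carrier n → Carrier
  fA {n} b a x =
    sumFin (λ j → lookup a (inject₁ j) * (lookup x j ^ b j)) + lookup a (fromℕ n)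

  firstN : ∀ {n d} → Vec Carrier (n ℕ.+ d) → Vec Carrier n
  firstN {n} p = tabulate (λ j → lookup p (j ↑ˡ _))

  InVariety : ∀ {n d} → (h : Fin d → Poly n) → (b : Fin d → Fin n → ℕ)
            → Vec Carrier (n ℕ.+ d) → Vec (Vec Carrier (suc n)) d → Set
  InVariety {n} {d} h b p as =
    ∀ (i : Fin d) → lookup p (n ↑ʳ i) ≡ eval (h i) (firstN p) + fA (b i) (lookup as i) (firstN p)

  inVariety? : ∀ {n d} h b p as → Dec (InVariety {n} {d} h b p as)
  inVariety? {n} {d} h b p as =
    all? (λ i → lookup p (n ↑ʳ i) ≟ (eval (h i) (firstN p) + fA (b i) (lookup as i) (firstN p)))

  -- I(P, V): number of pairs (p, V) ∈ P × V with p ∈ V, where V is given by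
  -- its parameter tuple (a_1, …, a_d).
  incidences : ∀ {n d} → (h : Fin d → Poly n) → (b : Fin d → Fin n → ℕ)
             → List (Vec Carrier (n ℕ.+ d)) → List (Vec (Vec Carrier (suc n)) d) → ℕ
  incidences h b P 𝒱 =
    sum (map (λ p → sum (map (λ as → if isYes (inVariety? h b p as) then 1 else 0) 𝒱)) P)

{-# OPTIONS --safe #-}
module Submission where

-- Write F^(n+d) = X × Y with X = F^n, Y = F^d, Q = |Y| = q^d. Every V_a is the graph of a map
-- X → Y, and two distinct ones agree on at most q^(n-1) points of X: in a coordinate j where
-- their coefficients differ, agreement determines x_j^(b_j), hence x_j (gcd(b_j, q-1) = 1).
-- Put f(s) = Q·[s ∈ P] - #(P on the fibre of s) and g(s) = Q·#{V ∋ s} - |𝒱|. Every graph meets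
-- every fibre once, so g sums to 0 over each fibre and Σ f g = Q (Q I - |P| |𝒱|). Moreover
-- Σ f² ≤ Q (Q - 1) |P|, and Σ g² = Q² Σ_{V,W} |V ∩ W| - Q q^n |𝒱|² is bounded through the
-- agreements. Cauchy–Schwarz then gives
--   (Q I - |P| |𝒱|)² ≤ (Q - 1) |P| |𝒱| (q^n (Q - |𝒱|) + Q (|𝒱| - 1) q^(n-1)),
-- which is the bound for d = 1 and implies the one for d ≥ 2.

open import Defs
open import Data.Nat as ℕ using (ℕ; zero; suc; _∸_)
open import Data.Nat.Coprimality using (Coprime)
open import Data.Integer as ℤ using (ℤ; +_)
open import Data.Fin using (Fin; zero; suc)
open import Data.Vec using (Vec; []; _∷_; lookup; tabulate; _[_]≔_)
open import Data.List using (List; []; _∷_; length; map)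
open import Data.List.Membership.Propositional using (_∈_)
open import Data.List.Relation.Unary.Any using (here; there)
open import Data.List.Relation.Unary.Unique.Propositional using (Unique)
open import Data.Product using (_×_; _,_; ∃; proj₁; proj₂)
open import Function using (_∘_)
open import Relation.Binary.Definitions using (DecidableEquality)
open import Relation.Binary.PropositionalEquality
  using (_≡_; _≢_; refl; sym; trans; cong; cong₂; subst; module ≡-Reasoning)
open import Relation.Nullary using (Dec; yes; no; ¬_; contradiction)

variable
  A B C : Set

-- Finite sums of integers

module _ where
  open import Data.Integer using (-[1+_]; 0ℤ; 1ℤ; _+_; _*_; _-_; -_; _≤_; +≤+; nonNegative)
  open import Data.Integer.Properties hiding (_≟_)
  open import Data.Integer.Tactic.RingSolver using (solve-∀)
  open import Data.List using (_++_; cartesianProductWith)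
  open import Data.Nat.ListAction using (sum)
  open import Algebra.Properties.CommutativeSemigroup +-commutativeSemigroup using (interchange)

  ∑ : List A → (A → ℤ) → ℤ
  ∑ []       f = 0ℤ
  ∑ (a ∷ as) f = f a + ∑ as f

  infixl 10 ∑
  syntax ∑ xs (λ x → e) = ∑[ x ∈ xs ] e

  ∑-cong : ∀ xs {f g : A → ℤ} → (∀ a → f a ≡ g a) → ∑ xs f ≡ ∑ xs g
  ∑-cong []       f≗g = refl
  ∑-cong (a ∷ as) f≗g = cong₂ _+_ (f≗g a) (∑-cong as f≗g)

  ∑-distrib-+ : ∀ xs (f g : A → ℤ) → ∑[ a ∈ xs ] (f a + g a) ≡ ∑ xs f + ∑ xs g
  ∑-distrib-+ []       f g = refl
  ∑-distrib-+ (a ∷ as) f g = begin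
    (f a + g a) + ∑[ b ∈ as ] (f b + g b) ≡⟨ cong (_+_ (f a + g a)) (∑-distrib-+ as f g) ⟩
    (f a + g a) + (∑ as f + ∑ as g)       ≡⟨ interchange (f a) (g a) (∑ as f) (∑ as g) ⟩
    (f a + ∑ as f) + (g a + ∑ as g)       ∎
    where open ≡-Reasoning

  neg-distrib-∑ : ∀ xs (f : A → ℤ) → - ∑ xs f ≡ ∑[ a ∈ xs ] (- f a)
  neg-distrib-∑ []       f = refl
  neg-distrib-∑ (a ∷ as) f = trans (neg-distrib-+ (f a) (∑ as f)) (cong (_+_ (- f a)) (neg-distrib-∑ as f))

  ∑-distrib-minus : ∀ xs (f g : A → ℤ) → ∑[ a ∈ xs ] (f a - g a) ≡ ∑ xs f - ∑ xs g
  ∑-distrib-minus xs f g =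
    trans (∑-distrib-+ xs f (-_ ∘ g)) (cong (_+_ (∑ xs f)) (sym (neg-distrib-∑ xs g)))

  *-distribˡ-∑ : ∀ xs k (f : A → ℤ) → k * ∑ xs f ≡ ∑[ a ∈ xs ] (k * f a)
  *-distribˡ-∑ []       k f = *-zeroʳ k
  *-distribˡ-∑ (a ∷ as) k f =
    trans (*-distribˡ-+ k (f a) (∑ as f)) (cong (_+_ (k * f a)) (*-distribˡ-∑ as k f))

  *-distribʳ-∑ : ∀ xs k (f : A → ℤ) → ∑ xs f * k ≡ ∑[ a ∈ xs ] (f a * k)
  *-distribʳ-∑ xs k f = begin
    ∑ xs f * k            ≡⟨ *-comm (∑ xs f) k ⟩
    k * ∑ xs f            ≡⟨ *-distribˡ-∑ xs k f ⟩
    ∑[ a ∈ xs ] (k * f a) ≡⟨ ∑-cong xs (λ a → *-comm k (f a)) ⟩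
    ∑[ a ∈ xs ] (f a * k) ∎
    where open ≡-Reasoning

  ∑-linear : ∀ xs k l (f g : A → ℤ) → ∑[ a ∈ xs ] (k * f a - l * g a) ≡ k * ∑ xs f - l * ∑ xs g
  ∑-linear xs k l f g = trans (∑-distrib-minus xs _ _)
    (sym (cong₂ _-_ (*-distribˡ-∑ xs k f) (*-distribˡ-∑ xs l g)))

  ∑-const : ∀ (xs : List A) k → ∑[ _ ∈ xs ] k ≡ + length xs * k
  ∑-const []       k = refl
  ∑-const (_ ∷ as) k = begin
    k + ∑[ _ ∈ as ] k        ≡⟨ cong (_+_ k) (∑-const as k) ⟩
    k + + length as * k      ≡⟨ cong (_+ + length as * k) (*-identityˡ k) ⟨
    1ℤ * k + + length as * k ≡⟨ *-distribʳ-+ k 1ℤ (+ length as) ⟨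
    + suc (length as) * k    ∎
    where open ≡-Reasoning

  ∑-zero : ∀ (xs : List A) → ∑[ _ ∈ xs ] 0ℤ ≡ 0ℤ
  ∑-zero xs = trans (∑-const xs 0ℤ) (*-zeroʳ (+ length xs))

  ∑-one : ∀ (xs : List A) → ∑[ _ ∈ xs ] 1ℤ ≡ + length xs
  ∑-one xs = trans (∑-const xs 1ℤ) (*-identityʳ (+ length xs))

  ∑-comm : ∀ xs ys (f : A → B → ℤ) →
           ∑[ a ∈ xs ] ∑[ b ∈ ys ] f a b ≡ ∑[ b ∈ ys ] ∑[ a ∈ xs ] f a b
  ∑-comm []       ys f = sym (∑-zero ys)
  ∑-comm (a ∷ as) ys f = trans (cong (_+_ (∑ ys (f a))) (∑-comm as ys f))
                               (sym (∑-distrib-+ ys (f a) (λ b → ∑[ a′ ∈ as ] f a′ b)))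

  ∑-*-∑ : ∀ xs ys (f : A → ℤ) (g : B → ℤ) →
          ∑ xs f * ∑ ys g ≡ ∑[ a ∈ xs ] ∑[ b ∈ ys ] (f a * g b)
  ∑-*-∑ xs ys f g = trans (*-distribʳ-∑ xs (∑ ys g) f) (∑-cong xs (λ a → *-distribˡ-∑ ys (f a) g))

  ∑-++ : ∀ xs ys (f : A → ℤ) → ∑ (xs ++ ys) f ≡ ∑ xs f + ∑ ys f
  ∑-++ []       ys f = sym (+-identityˡ (∑ ys f))
  ∑-++ (a ∷ as) ys f = trans (cong (_+_ (f a)) (∑-++ as ys f)) (sym (+-assoc (f a) (∑ as f) (∑ ys f)))

  ∑-map : ∀ (g : A → B) xs (f : B → ℤ) → ∑ (map g xs) f ≡ ∑ xs (f ∘ g)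
  ∑-map g []       f = refl
  ∑-map g (a ∷ as) f = cong (_+_ (f (g a))) (∑-map g as f)

  ∑-cartesianProductWith : ∀ (_⊗_ : A → B → C) xs ys (f : C → ℤ) →
                           ∑ (cartesianProductWith _⊗_ xs ys) f ≡ ∑[ a ∈ xs ] ∑[ b ∈ ys ] f (a ⊗ b)
  ∑-cartesianProductWith _⊗_ []       ys f = refl
  ∑-cartesianProductWith _⊗_ (a ∷ as) ys f = begin
    ∑ (map (a ⊗_) ys ++ cartesianProductWith _⊗_ as ys) f
      ≡⟨ ∑-++ (map (a ⊗_) ys) _ f ⟩
    ∑ (map (a ⊗_) ys) f + ∑ (cartesianProductWith _⊗_ as ys) f
      ≡⟨ cong₂ _+_ (∑-map (a ⊗_) ys f) (∑-cartesianProductWith _⊗_ as ys f) ⟩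
    ∑[ b ∈ ys ] f (a ⊗ b) + ∑[ a′ ∈ as ] ∑[ b ∈ ys ] f (a′ ⊗ b) ∎
    where open ≡-Reasoning

  +-sum : ∀ xs (f : A → ℕ) → + sum (map f xs) ≡ ∑[ a ∈ xs ] (+ f a)
  +-sum []       f = refl
  +-sum (a ∷ as) f = trans (pos-+ (f a) (sum (map f as))) (cong (_+_ (+ f a)) (+-sum as f))

  ∑-mono-≤ : ∀ xs {f g : A → ℤ} → (∀ {a} → a ∈ xs → f a ≤ g a) → ∑ xs f ≤ ∑ xs g
  ∑-mono-≤ []       f≤g = ≤-refl
  ∑-mono-≤ (a ∷ as) f≤g = +-mono-≤ (f≤g (here refl)) (∑-mono-≤ as (f≤g ∘ there))

  ∑-nonNeg : ∀ xs {f : A → ℤ} → (∀ a → 0ℤ ≤ f a) → 0ℤ ≤ ∑ xs f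
  ∑-nonNeg xs 0≤f = ≤-trans (≤-reflexive (sym (∑-zero xs))) (∑-mono-≤ xs (λ {a} _ → 0≤f a))

  *-mono-≤-nonNeg : ∀ {i j k l} → 0ℤ ≤ i → 0ℤ ≤ k → i ≤ j → k ≤ l → i * k ≤ j * l
  *-mono-≤-nonNeg {j = j} {k} 0≤i 0≤k i≤j k≤l =
    ≤-trans (*-monoʳ-≤-nonNeg k {{nonNegative 0≤k}} i≤j)
            (*-monoˡ-≤-nonNeg j {{nonNegative (≤-trans 0≤i i≤j)}} k≤l)

  *-nonNeg : ∀ {i j} → 0ℤ ≤ i → 0ℤ ≤ j → 0ℤ ≤ i * j
  *-nonNeg = *-mono-≤-nonNeg ≤-refl ≤-refl

  square-nonNeg : ∀ i → 0ℤ ≤ i * i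
  square-nonNeg (+ n)    = subst (0ℤ ≤_) (pos-* n n) (+≤+ ℕ.z≤n)
  square-nonNeg -[1+ n ] = +≤+ ℕ.z≤n

  -- No integer lies strictly between 0 and 1.
  k*[k-1]-nonNeg : ∀ k → 0ℤ ≤ k * (k - 1ℤ)
  k*[k-1]-nonNeg (+ zero)  = ≤-refl
  k*[k-1]-nonNeg (+ suc n) = subst (0ℤ ≤_) (pos-* (suc n) n) (+≤+ ℕ.z≤n)
  k*[k-1]-nonNeg -[1+ n ]  = +≤+ ℕ.z≤n

  lagrange-identity : ∀ xs (f g : A → ℤ) →
                      ∑[ a ∈ xs ] ∑[ b ∈ xs ] ((f a * g b - f b * g a) * (f a * g b - f b * g a))
                      ≡ + 2 * (∑[ a ∈ xs ] (f a * f a) * ∑[ a ∈ xs ] (g a * g a)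
                               - ∑[ a ∈ xs ] (f a * g a) * ∑[ a ∈ xs ] (f a * g a))
  lagrange-identity {A} xs f g = begin
    ∑[ a ∈ xs ] ∑[ b ∈ xs ] ((f a * g b - f b * g a) * (f a * g b - f b * g a))
      ≡⟨ ∑-cong xs (λ a → ∑-cong xs (λ b → expand (f a) (f b) (g a) (g b))) ⟩
    ∑[ a ∈ xs ] ∑[ b ∈ xs ] (g b * g b * (f a * f a) + f b * f b * (g a * g a)
                              - + 2 * (f b * g b * (f a * g a)))
      ≡⟨ ∑-cong xs (λ a → ∑-expand _ _ _ (f a * f a) (g a * g a) (f a * g a)) ⟩
    ∑[ a ∈ xs ] (G * (f a * f a) + F * (g a * g a) - + 2 * (H * (f a * g a)))
      ≡⟨ ∑-cong xs (λ a → commute F G H (f a * f a) (g a * g a) (f a * g a)) ⟩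
    ∑[ a ∈ xs ] (f a * f a * G + g a * g a * F - + 2 * (f a * g a * H))
      ≡⟨ ∑-expand _ _ _ G F H ⟩
    F * G + G * F - + 2 * (H * H)
      ≡⟨ collect F G H ⟩
    + 2 * (F * G - H * H) ∎
    where
    open ≡-Reasoning
    F = ∑[ a ∈ xs ] (f a * f a)
    G = ∑[ a ∈ xs ] (g a * g a)
    H = ∑[ a ∈ xs ] (f a * g a)
    expand : ∀ fa fb ga gb → (fa * gb - fb * ga) * (fa * gb - fb * ga)
                           ≡ gb * gb * (fa * fa) + fb * fb * (ga * ga) - + 2 * (fb * gb * (fa * ga))
    expand = solve-∀
    commute : ∀ F G H p r w → G * p + F * r - + 2 * (H * w) ≡ p * G + r * F - + 2 * (w * H)
    commute = solve-∀
    collect : ∀ F G H → F * G + G * F - + 2 * (H * H) ≡ + 2 * (F * G - H * H)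
    collect = solve-∀
    ∑-expand : ∀ (u v w : A → ℤ) U V W → ∑[ a ∈ xs ] (u a * U + v a * V - + 2 * (w a * W))
                                         ≡ ∑ xs u * U + ∑ xs v * V - + 2 * (∑ xs w * W)
    ∑-expand u v w U V W = begin
      ∑[ a ∈ xs ] (u a * U + v a * V - + 2 * (w a * W))
        ≡⟨ ∑-distrib-minus xs _ _ ⟩
      ∑[ a ∈ xs ] (u a * U + v a * V) - ∑[ a ∈ xs ] (+ 2 * (w a * W))
        ≡⟨ cong₂ _-_ (∑-distrib-+ xs _ _) (sym (*-distribˡ-∑ xs (+ 2) _)) ⟩
      ∑[ a ∈ xs ] (u a * U) + ∑[ a ∈ xs ] (v a * V) - + 2 * ∑[ a ∈ xs ] (w a * W)
        ≡⟨ cong₂ _-_ (cong₂ _+_ (*-distribʳ-∑ xs U u) (*-distribʳ-∑ xs V v))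
                     (cong (+ 2 *_) (*-distribʳ-∑ xs W w)) ⟨
      ∑ xs u * U + ∑ xs v * V - + 2 * (∑ xs w * W) ∎

  cauchy-schwarz : ∀ xs (f g : A → ℤ) →
                   ∑[ a ∈ xs ] (f a * g a) * ∑[ a ∈ xs ] (f a * g a) ≤
                   ∑[ a ∈ xs ] (f a * f a) * ∑[ a ∈ xs ] (g a * g a)
  cauchy-schwarz xs f g = 0≤i-j⇒j≤i (*-cancelˡ-≤-pos 0ℤ _ (+ 2)
    (≤-trans (∑-nonNeg xs λ a → ∑-nonNeg xs λ b → square-nonNeg (f a * g b - f b * g a))
             (≤-reflexive (lagrange-identity xs f g))))

module _ where
  open import Data.Integer using (0ℤ; 1ℤ; _+_; _*_; _≤_; +≤+)
  open import Data.Integer.Properties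
    using (*-zeroˡ; *-identityˡ; *-identityʳ; +-identityˡ; +-identityʳ; ≤-trans; ≤-reflexive)
  open import Data.Bool using (if_then_else_)
  open import Data.List.Relation.Unary.All as All using (All; []; _∷_)
  open import Data.List.Relation.Unary.All.Properties using (All¬⇒¬Any)
  open import Data.List.Relation.Unary.AllPairs using ([]; _∷_)
  import Data.List.Membership.DecPropositional as DecMembership
  open import Relation.Nullary.Decidable using (isYes)

  -- Written as in `incidences`, so that an incidence count is definitionally a sum of indicators.
  𝟙 : Dec A → ℤ
  𝟙 A? = + (if isYes A? then 1 else 0)

  𝟙-yes : (A? : Dec A) → A → 𝟙 A? ≡ 1ℤ
  𝟙-yes (yes _) _ = refl
  𝟙-yes (no ¬a) a = contradiction a ¬a

  𝟙-no : (A? : Dec A) → ¬ A → 𝟙 A? ≡ 0ℤ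
  𝟙-no (yes a) ¬a = contradiction a ¬a
  𝟙-no (no _)  _  = refl

  𝟙-cong : (A? : Dec A) (B? : Dec B) → (A → B) → (B → A) → 𝟙 A? ≡ 𝟙 B?
  𝟙-cong (yes a) B? f g = sym (𝟙-yes B? (f a))
  𝟙-cong (no ¬a) B? f g = sym (𝟙-no B? (¬a ∘ g))

  𝟙-idem : (A? : Dec A) → 𝟙 A? * 𝟙 A? ≡ 𝟙 A?
  𝟙-idem (yes _) = refl
  𝟙-idem (no _)  = refl

  module _ (_≟_ : DecidableEquality A) where
    open DecMembership _≟_ using (_∈?_; _∉_)

    ∑-𝟙≟-∉ : ∀ {xs c} → c ∉ xs → (g : A → ℤ) → ∑[ a ∈ xs ] (𝟙 (c ≟ a) * g a) ≡ 0ℤ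
    ∑-𝟙≟-∉ {[]}     c∉xs g = refl
    ∑-𝟙≟-∉ {x ∷ xs} c∉xs g = cong₂ _+_
      (trans (cong (_* g x) (𝟙-no (_ ≟ x) (c∉xs ∘ here))) (*-zeroˡ (g x)))
      (∑-𝟙≟-∉ (c∉xs ∘ there) g)

    ∑-𝟙≟-∈ : ∀ {xs c} → Unique xs → c ∈ xs → (g : A → ℤ) →
             ∑[ a ∈ xs ] (𝟙 (c ≟ a) * g a) ≡ g c
    ∑-𝟙≟-∈ {x ∷ xs} (x∉xs ∷ _) (here refl) g = begin
      𝟙 (x ≟ x) * g x + ∑[ a ∈ xs ] (𝟙 (x ≟ a) * g a)
        ≡⟨ cong₂ _+_ (cong (_* g x) (𝟙-yes (x ≟ x) refl)) (∑-𝟙≟-∉ (All¬⇒¬Any x∉xs) g) ⟩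
      1ℤ * g x + 0ℤ ≡⟨ +-identityʳ (1ℤ * g x) ⟩
      1ℤ * g x      ≡⟨ *-identityˡ (g x) ⟩
      g x           ∎
      where open ≡-Reasoning
    ∑-𝟙≟-∈ {x ∷ xs} {c} (x∉xs ∷ xs-unique) (there c∈xs) g = begin
      𝟙 (c ≟ x) * g x + ∑[ a ∈ xs ] (𝟙 (c ≟ a) * g a)
        ≡⟨ cong₂ _+_ (cong (_* g x) (𝟙-no (c ≟ x) c≢x)) (∑-𝟙≟-∈ xs-unique c∈xs g) ⟩
      0ℤ * g x + g c ≡⟨ cong (_+ g c) (*-zeroˡ (g x)) ⟩
      0ℤ + g c       ≡⟨ +-identityˡ (g c) ⟩
      g c            ∎
      where
      open ≡-Reasoning
      c≢x : c ≢ x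
      c≢x c≡x = All.lookup x∉xs c∈xs (sym c≡x)

    ∑-𝟙≟ : ∀ {xs} → Unique xs → ∀ c → ∑[ a ∈ xs ] 𝟙 (c ≟ a) ≡ 𝟙 (c ∈? xs)
    ∑-𝟙≟ {xs} xs-unique c = trans (∑-cong xs (λ a → sym (*-identityʳ (𝟙 (c ≟ a))))) (sift (c ∈? xs))
      where
      sift : (c∈?xs : Dec (c ∈ xs)) → ∑[ a ∈ xs ] (𝟙 (c ≟ a) * 1ℤ) ≡ 𝟙 c∈?xs
      sift (yes c∈xs) = ∑-𝟙≟-∈ xs-unique c∈xs (λ _ → 1ℤ)
      sift (no c∉xs)  = ∑-𝟙≟-∉ c∉xs (λ _ → 1ℤ)

  ∑-𝟙-none : ∀ {P : A → Set} (P? : ∀ a → Dec (P a)) {xs} → All (¬_ ∘ P) xs →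
             ∑[ a ∈ xs ] 𝟙 (P? a) ≡ 0ℤ
  ∑-𝟙-none P? []           = refl
  ∑-𝟙-none P? (¬pa ∷ ¬pas) = cong₂ _+_ (𝟙-no (P? _) ¬pa) (∑-𝟙-none P? ¬pas)

  ∑-𝟙-≤1 : ∀ {P : A → Set} (P? : ∀ a → Dec (P a)) → (∀ {a b} → P a → P b → a ≡ b) →
            ∀ {xs} → Unique xs → ∑[ a ∈ xs ] 𝟙 (P? a) ≤ 1ℤ
  ∑-𝟙-≤1 P? P-unique []                 = +≤+ ℕ.z≤n
  ∑-𝟙-≤1 P? P-unique {x ∷ xs} (x∉xs ∷ xs-unique) with P? x
  ... | yes px =
    ≤-reflexive (cong (_+_ 1ℤ) (∑-𝟙-none P? (All.map (λ x≢a pa → x≢a (P-unique px pa)) x∉xs)))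
  ... | no _   = ≤-trans (≤-reflexive (+-identityˡ _)) (∑-𝟙-≤1 P? P-unique xs-unique)

-- Enumerated types

record Enumerated (A : Set) : Set where
  field
    _≟_      : DecidableEquality A
    elements : List A
    unique   : Unique elements
    complete : ∀ a → a ∈ elements

  size : ℕ
  size = length elements

module _ where
  open import Data.Integer using (1ℤ; _*_; _≤_)
  open import Data.Integer.Properties using (*-identityʳ; pos-*; ≤-reflexive; module ≤-Reasoning)
  open import Data.List using ([_]; _++_; cartesianProductWith; cartesianProduct)
  open import Data.List.Properties using (length-++; length-map)
  open import Data.List.Membership.Propositional.Properties using (∈-cartesianProductWith⁺; ∈-cartesianProduct⁺)
  import Data.List.Membership.DecPropositional as DecMembership
  open import Data.List.Relation.Unary.All using ([])
  open import Data.List.Relation.Unary.AllPairs using ([]; _∷_)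
  open import Data.List.Relation.Unary.Unique.Propositional.Properties
    using (cartesianProductWith⁺; cartesianProduct⁺)
  import Data.Product.Properties as Product
  import Data.Vec.Properties as Vec

  ×-enumerated : Enumerated A → Enumerated B → Enumerated (A × B)
  ×-enumerated 𝔸 𝔹 = record
    { _≟_      = Product.≡-dec (𝔸 .Enumerated._≟_) (𝔹 .Enumerated._≟_)
    ; elements = cartesianProduct (𝔸 .Enumerated.elements) (𝔹 .Enumerated.elements)
    ; unique   = cartesianProduct⁺ (𝔸 .Enumerated.unique) (𝔹 .Enumerated.unique)
    ; complete = λ (a , b) → ∈-cartesianProduct⁺ (𝔸 .Enumerated.complete a) (𝔹 .Enumerated.complete b)
    }

  length-cartesianProductWith : ∀ (_⊗_ : A → B → C) xs ys →
                                length (cartesianProductWith _⊗_ xs ys) ≡ length xs ℕ.* length ys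
  length-cartesianProductWith _⊗_ []       ys = refl
  length-cartesianProductWith _⊗_ (x ∷ xs) ys = begin
    length (map (x ⊗_) ys ++ cartesianProductWith _⊗_ xs ys)
      ≡⟨ length-++ (map (x ⊗_) ys) ⟩
    length (map (x ⊗_) ys) ℕ.+ length (cartesianProductWith _⊗_ xs ys)
      ≡⟨ cong₂ ℕ._+_ (length-map (x ⊗_) ys)
        (length-cartesianProductWith _⊗_ xs ys) ⟩
    length ys ℕ.+ length xs ℕ.* length ys ∎
    where open ≡-Reasoning

  module _ (𝔸 : Enumerated A) where
    open Enumerated 𝔸
    open DecMembership _≟_ using (_∈?_)

    ∑-𝟙∈? : ∀ {P} → Unique P → (f : A → ℤ) →
            ∑[ a ∈ elements ] (𝟙 (a ∈? P) * f a) ≡ ∑ P f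
    ∑-𝟙∈? {P} P-unique f = begin
      ∑[ a ∈ elements ] (𝟙 (a ∈? P) * f a)
        ≡⟨ ∑-cong elements (λ a → cong (_* f a) (∑-𝟙≟ _≟_ P-unique a)) ⟨
      ∑[ a ∈ elements ] (∑[ p ∈ P ] 𝟙 (a ≟ p) * f a)
        ≡⟨ ∑-cong elements (λ a → *-distribʳ-∑ P (f a) _) ⟩
      ∑[ a ∈ elements ] ∑[ p ∈ P ] (𝟙 (a ≟ p) * f a)
        ≡⟨ ∑-comm elements P _ ⟩
      ∑[ p ∈ P ] ∑[ a ∈ elements ] (𝟙 (a ≟ p) * f a)
        ≡⟨ ∑-cong P (λ p → ∑-cong elements (λ a →
          cong (_* f a) (𝟙-cong (a ≟ p) (p ≟ a) sym sym))) ⟩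
      ∑[ p ∈ P ] ∑[ a ∈ elements ] (𝟙 (p ≟ a) * f a)
        ≡⟨ ∑-cong P (λ p → ∑-𝟙≟-∈ _≟_ unique (complete p) f) ⟩
      ∑ P f ∎
      where open ≡-Reasoning

    vectors : ∀ m → List (Vec A m)
    vectors zero    = [ [] ]
    vectors (suc m) = cartesianProductWith _∷_ elements (vectors m)

    vectors-unique : ∀ m → Unique (vectors m)
    vectors-unique zero    = [] ∷ []
    vectors-unique (suc m) = cartesianProductWith⁺ _∷_ Vec.∷-injective unique (vectors-unique m)

    vectors-complete : ∀ {m} (x : Vec A m) → x ∈ vectors m
    vectors-complete []      = here refl
    vectors-complete (a ∷ x) = ∈-cartesianProductWith⁺ _∷_ (complete a) (vectors-complete x)

    length-vectors : ∀ m → length (vectors m) ≡ size ℕ.^ m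
    length-vectors zero    = refl
    length-vectors (suc m) =
      trans (length-cartesianProductWith _∷_ elements (vectors m)) (cong (size ℕ.*_) (length-vectors m))

    Vec-enumerated : ∀ m → Enumerated (Vec A m)
    Vec-enumerated m = record
      { _≟_      = Vec.≡-dec _≟_
      ; elements = vectors m
      ; unique   = vectors-unique m
      ; complete = vectors-complete
      }

    line-count : ∀ {m} (j : Fin (suc m)) {S : Vec A (suc m) → Set} (S? : ∀ x → Dec (S x)) →
                 (∀ x t → S x → S (x [ j ]≔ t) → t ≡ lookup x j) →
                 ∑[ x ∈ vectors (suc m) ] 𝟙 (S? x) ≤ + (size ℕ.^ m)
    line-count {m} zero S? on-lines = begin
      ∑[ x ∈ vectors (suc m) ] 𝟙 (S? x)
        ≡⟨ ∑-cartesianProductWith _∷_ elements (vectors m) _ ⟩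
      ∑[ a ∈ elements ] ∑[ w ∈ vectors m ] 𝟙 (S? (a ∷ w))
        ≡⟨ ∑-comm elements (vectors m) _ ⟩
      ∑[ w ∈ vectors m ] ∑[ a ∈ elements ] 𝟙 (S? (a ∷ w))
        ≤⟨ ∑-mono-≤ (vectors m) (λ _ →
          ∑-𝟙-≤1 _ (λ Sa Sb → sym (on-lines _ _ Sa Sb)) unique) ⟩
      ∑[ w ∈ vectors m ] 1ℤ
        ≡⟨ ∑-one (vectors m) ⟩
      + length (vectors m)
        ≡⟨ cong +_ (length-vectors m) ⟩
      + (size ℕ.^ m) ∎
      where open ≤-Reasoning
    line-count {suc m} (suc j) S? on-lines = begin
      ∑[ x ∈ vectors (suc (suc m)) ] 𝟙 (S? x)
        ≡⟨ ∑-cartesianProductWith _∷_ elements (vectors (suc m)) _ ⟩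
      ∑[ a ∈ elements ] ∑[ w ∈ vectors (suc m) ] 𝟙 (S? (a ∷ w))
        ≤⟨ ∑-mono-≤ elements (λ {a} _ →
          line-count j (S? ∘ (a ∷_)) (on-lines ∘ (a ∷_))) ⟩
      ∑[ _ ∈ elements ] (+ (size ℕ.^ m))
        ≡⟨ ∑-const elements _ ⟩
      + size * + (size ℕ.^ m)
        ≡⟨ pos-* size (size ℕ.^ m) ⟨
      + (size ℕ.^ suc m) ∎
      where open ≤-Reasoning

-- Finite fields

module _ where
  open import Data.List.Membership.Propositional.Properties.WithK using (unique∧set⇒bag)
  open import Data.List.Relation.Binary.BagAndSetEquality using (∼bag⇒↭)
  open import Data.List.Relation.Binary.Permutation.Propositional using (_↭_)
  open import Function using (_⇔_)

  unique∧set⇒↭ : ∀ {xs ys : List A} → Unique xs → Unique ys →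
                 (∀ {a} → a ∈ xs ⇔ a ∈ ys) → xs ↭ ys
  unique∧set⇒↭ xs-unique ys-unique xs⇔ys = ∼bag⇒↭ (unique∧set⇒bag xs-unique ys-unique xs⇔ys)

field-enumerated : (F : FiniteField) → Enumerated (FiniteField.Carrier F)
field-enumerated F = record
  { _≟_      = FiniteField._≟_ F
  ; elements = FiniteField.elements F
  ; unique   = FiniteField.elements-unique F
  ; complete = FiniteField.elements-complete F
  }

module FiniteFieldProperties (F : FiniteField) where
  open FiniteField F
  open import Level using (0ℓ)
  open import Algebra.Bundles using (CommutativeRing)
  open import Algebra.Consequences.Propositional using (comm∧idˡ⇒id; comm∧invˡ⇒inv; comm∧distrˡ⇒distrʳ)
  open import Data.Fin.Properties using (any?; suc-injective)
  open import Data.Fin.Relation.Unary.Top using (view; ‵fromℕ; ‵inject₁)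
  open import Data.Fin using (inject₁; fromℕ)
  open import Data.Maybe using (nothing)
  open import Data.Nat.GCD using (module Bézout)
  open import Data.Nat.Coprimality using (coprime-Bézout)
  import Data.Nat.Properties as ℕ
  open import Data.List using (filter; foldr)
  open import Data.List.Membership.Propositional.Properties using (∈-map⁺; ∈-map⁻; ∈-filter⁺; ∈-filter⁻)
  open import Data.List.Relation.Unary.All as All using ()
  open import Data.List.Relation.Unary.AllPairs using (_∷_)
  import Data.List.Relation.Unary.Unique.Propositional.Properties as Unique
  open import Data.List.Relation.Binary.Permutation.Propositional using (_↭_; ↭⇒↭ₛ)
  open import Data.List.Relation.Binary.Permutation.Propositional.Properties using (↭-length)
  import Data.List.Relation.Binary.Permutation.Setoid.Properties as Permutation
  open import Data.Vec.Properties using (lookup∘update; lookup∘update′)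
  open import Data.Vec.Relation.Binary.Pointwise.Extensional using (ext; Pointwise-≡⇒≡)
  open import Function using (mk⇔)
  open import Relation.Binary.PropositionalEquality using (isEquivalence; setoid)
  open import Relation.Nullary using (¬?)
  open import Relation.Nullary.Decidable using (decidable-stable)
  import Tactic.RingSolver.Core.AlmostCommutativeRing as ACR

  commutativeRing : CommutativeRing 0ℓ 0ℓ
  commutativeRing = record
    { isCommutativeRing = record
      { isRing = record
        { +-isAbelianGroup = record
          { isGroup = record
            { isMonoid = record
              { isSemigroup = record
                { isMagma = record { isEquivalence = isEquivalence ; ∙-cong = cong₂ _+_ }
                ; assoc   = +-assoc
                }
              ; identity = comm∧idˡ⇒id +-comm +-identityˡ
              }
            ; inverse = comm∧invˡ⇒inv +-comm -‿inverseˡ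
            ; ⁻¹-cong = cong -_
            }
          ; comm = +-comm
          }
        ; *-cong     = cong₂ _*_
        ; *-assoc    = *-assoc
        ; *-identity = comm∧idˡ⇒id *-comm *-identityˡ
        ; distrib    = distribˡ , comm∧distrˡ⇒distrʳ *-comm distribˡ
        }
      ; *-comm = *-comm
      }
    }

  open CommutativeRing commutativeRing
    using ( _-_; ring; *-isCommutativeMonoid; *-commutativeSemigroup; +-commutativeSemigroup
          ; *-identityʳ; zeroˡ; zeroʳ)
  open import Algebra.Properties.Ring ring using (+-cancelˡ; +-cancelʳ; x∙y⁻¹≈ε⇒x≈y; //-rightDividesˡ)
  open import Algebra.Properties.CommutativeSemigroup *-commutativeSemigroup using (x∙yz≈xz∙y; interchange)
  open import Algebra.Properties.CommutativeSemigroup +-commutativeSemigroup using (xy∙z≈xz∙y; xy∙z≈zy∙x)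

  almostCommutativeRing : ACR.AlmostCommutativeRing 0ℓ 0ℓ
  almostCommutativeRing = ACR.fromCommutativeRing commutativeRing (λ _ → nothing)

  open import Tactic.RingSolver.NonReflective almostCommutativeRing using (solve; _⊜_; _⊕_; _⊗_)

  *-cancelʳ-≢0 : ∀ {a b c} → c ≢ 0# → a * c ≡ b * c → a ≡ b
  *-cancelʳ-≢0 {a} {b} {c} c≢0 ac≡bc with inverse c c≢0
  ... | c⁻¹ , c⁻¹c≡1 = begin
    a             ≡⟨ *-identityʳ a ⟨
    a * 1#        ≡⟨ cong (a *_) c⁻¹c≡1 ⟨
    a * (c⁻¹ * c) ≡⟨ x∙yz≈xz∙y a c⁻¹ c ⟩
    a * c * c⁻¹   ≡⟨ cong (_* c⁻¹) ac≡bc ⟩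
    b * c * c⁻¹   ≡⟨ x∙yz≈xz∙y b c⁻¹ c ⟨
    b * (c⁻¹ * c) ≡⟨ cong (b *_) c⁻¹c≡1 ⟩
    b * 1#        ≡⟨ *-identityʳ b ⟩
    b             ∎
    where open ≡-Reasoning

  *-≢0 : ∀ {a b} → a ≢ 0# → b ≢ 0# → a * b ≢ 0#
  *-≢0 {a} {b} a≢0 b≢0 ab≡0 = a≢0 (*-cancelʳ-≢0 b≢0 (trans ab≡0 (sym (zeroˡ b))))

  ^-+ : ∀ x m n → x ^ (m ℕ.+ n) ≡ x ^ m * x ^ n
  ^-+ x zero    n = sym (*-identityˡ (x ^ n))
  ^-+ x (suc m) n = trans (cong (x *_) (^-+ x m n)) (sym (*-assoc x (x ^ m) (x ^ n)))

  ^-* : ∀ x m n → x ^ (m ℕ.* n) ≡ (x ^ m) ^ n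
  ^-* x m zero    = cong (x ^_) (ℕ.*-zeroʳ m)
  ^-* x m (suc n) = begin
    x ^ (m ℕ.* suc n)     ≡⟨ cong (x ^_) (ℕ.*-suc m n) ⟩
    x ^ (m ℕ.+ m ℕ.* n)   ≡⟨ ^-+ x m (m ℕ.* n) ⟩
    x ^ m * x ^ (m ℕ.* n) ≡⟨ cong (x ^ m *_) (^-* x m n) ⟩
    x ^ m * (x ^ m) ^ n   ∎
    where open ≡-Reasoning

  ^-≢0 : ∀ {x} → x ≢ 0# → ∀ n → x ^ n ≢ 0#
  ^-≢0 x≢0 zero    = 0≢1 ∘ sym
  ^-≢0 x≢0 (suc n) = *-≢0 x≢0 (^-≢0 x≢0 n)

  ≢0? : ∀ a → Dec (a ≢ 0#)
  ≢0? a = ¬? (a ≟ 0#)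

  nonzero : List Carrier
  nonzero = filter ≢0? elements

  ∈-nonzero : ∀ {a} → a ≢ 0# → a ∈ nonzero
  ∈-nonzero a≢0 = ∈-filter⁺ ≢0? (elements-complete _) a≢0

  nonzero-≢0 : ∀ {a} → a ∈ nonzero → a ≢ 0#
  nonzero-≢0 = proj₂ ∘ ∈-filter⁻ ≢0? {xs = elements}

  nonzero-unique : Unique nonzero
  nonzero-unique = Unique.filter⁺ ≢0? elements-unique

  size≡1+∣nonzero∣ : size ≡ suc (length nonzero)
  size≡1+∣nonzero∣ =
    ↭-length (unique∧set⇒↭ elements-unique 0∷nonzero-unique
                           (mk⇔ zero-or-not (λ _ → elements-complete _)))
    where
    0∷nonzero-unique : Unique (0# ∷ nonzero)
    0∷nonzero-unique = All.tabulate (λ a∈nonzero 0≡a → nonzero-≢0 a∈nonzero (sym 0≡a)) ∷ nonzero-unique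
    zero-or-not : ∀ {a} → a ∈ elements → a ∈ 0# ∷ nonzero
    zero-or-not {a} _ with a ≟ 0#
    ... | yes a≡0 = here a≡0
    ... | no a≢0  = there (∈-nonzero a≢0)

  ∏ : List Carrier → Carrier
  ∏ = foldr _*_ 1#

  ∏-≢0 : ∀ {xs} → (∀ {a} → a ∈ xs → a ≢ 0#) → ∏ xs ≢ 0#
  ∏-≢0 {[]}     _    = 0≢1 ∘ sym
  ∏-≢0 {x ∷ xs} xs≢0 = *-≢0 (xs≢0 (here refl)) (∏-≢0 (xs≢0 ∘ there))

  ∏-map-* : ∀ x xs → ∏ (map (x *_) xs) ≡ x ^ length xs * ∏ xs
  ∏-map-* x []       = sym (*-identityˡ 1#)
  ∏-map-* x (y ∷ xs) = trans (cong (x * y *_) (∏-map-* x xs)) (interchange x y (x ^ length xs) (∏ xs))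

  -- Multiplication by x ≠ 0 permutes the nonzero elements, so it fixes their product.
  fermat : ∀ {x} → x ≢ 0# → x ^ (size ∸ 1) ≡ 1#
  fermat {x} x≢0 = *-cancelʳ-≢0 (∏-≢0 nonzero-≢0) (begin
    x ^ (size ∸ 1) * ∏ nonzero
      ≡⟨ cong (λ k → x ^ (k ∸ 1) * ∏ nonzero) size≡1+∣nonzero∣ ⟩
    x ^ length nonzero * ∏ nonzero
      ≡⟨ ∏-map-* x nonzero ⟨
    ∏ (map (x *_) nonzero)
      ≡⟨ Permutation.foldr-commMonoid (setoid Carrier) *-isCommutativeMonoid (↭⇒↭ₛ permuted) ⟩
    ∏ nonzero
      ≡⟨ *-identityˡ (∏ nonzero) ⟨
    1# * ∏ nonzero ∎)
    where
    open ≡-Reasoning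
    x*-injective : ∀ {a b} → x * a ≡ x * b → a ≡ b
    x*-injective {a} {b} xa≡xb = *-cancelʳ-≢0 x≢0 (trans (*-comm a x) (trans xa≡xb (*-comm x b)))
    into : ∀ {a} → a ∈ map (x *_) nonzero → a ∈ nonzero
    into a∈ with ∈-map⁻ (x *_) a∈
    ... | b , b∈nonzero , refl = ∈-nonzero (*-≢0 x≢0 (nonzero-≢0 b∈nonzero))
    onto : ∀ {a} → a ∈ nonzero → a ∈ map (x *_) nonzero
    onto {a} a∈nonzero with inverse x x≢0
    ... | x⁻¹ , x⁻¹x≡1 =
      subst (_∈ map (x *_) nonzero) x[x⁻¹a]≡a (∈-map⁺ (x *_) (∈-nonzero x⁻¹a≢0))
      where
      x[x⁻¹a]≡a : x * (x⁻¹ * a) ≡ a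
      x[x⁻¹a]≡a = trans (sym (*-assoc x x⁻¹ a))
                        (trans (cong (_* a) (trans (*-comm x x⁻¹) x⁻¹x≡1)) (*-identityˡ a))
      x⁻¹a≢0 : x⁻¹ * a ≢ 0#
      x⁻¹a≢0 x⁻¹a≡0 =
        nonzero-≢0 a∈nonzero (trans (sym x[x⁻¹a]≡a) (trans (cong (x *_) x⁻¹a≡0) (zeroʳ x)))
    permuted : map (x *_) nonzero ↭ nonzero
    permuted = unique∧set⇒↭ (Unique.map⁺ x*-injective nonzero-unique) nonzero-unique (mk⇔ into onto)

  ^-periodic : ∀ {x} → x ≢ 0# → ∀ k m → x ^ (k ℕ.+ m ℕ.* (size ∸ 1)) ≡ x ^ k
  ^-periodic {x} x≢0 k m = begin
    x ^ (k ℕ.+ m ℕ.* (size ∸ 1))   ≡⟨ ^-+ x k (m ℕ.* (size ∸ 1)) ⟩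
    x ^ k * x ^ (m ℕ.* (size ∸ 1)) ≡⟨ cong (x ^ k *_) (^-* x m (size ∸ 1)) ⟩
    x ^ k * (x ^ m) ^ (size ∸ 1)   ≡⟨ cong (x ^ k *_) (fermat (^-≢0 x≢0 m)) ⟩
    x ^ k * 1#                     ≡⟨ *-identityʳ (x ^ k) ⟩
    x ^ k                          ∎
    where open ≡-Reasoning

  ^-injective : ∀ {b} → 1 ℕ.≤ b → Coprime b (size ∸ 1) → ∀ {s t} → s ^ b ≡ t ^ b → s ≡ t
  ^-injective {suc b} _ b-coprime {s} {t} sᵇ≡tᵇ with s ≟ 0# | t ≟ 0#
  ... | yes s≡0  | yes t≡0  = trans s≡0 (sym t≡0)
  ... | yes refl | no t≢0   = contradiction (trans (sym sᵇ≡tᵇ) (zeroˡ _)) (^-≢0 t≢0 (suc b))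
  ... | no s≢0   | yes refl = contradiction (trans sᵇ≡tᵇ (zeroˡ _)) (^-≢0 s≢0 (suc b))
  ... | no s≢0   | no t≢0 with coprime-Bézout b-coprime
  ...   | Bézout.+- u v 1+v[q-1]≡u[1+b] = begin
    s               ≡⟨ root s≢0 ⟩
    (s ^ suc b) ^ u ≡⟨ cong (_^ u) sᵇ≡tᵇ ⟩
    (t ^ suc b) ^ u ≡⟨ root t≢0 ⟨
    t               ∎
    where
    open ≡-Reasoning
    root : ∀ {x} → x ≢ 0# → x ≡ (x ^ suc b) ^ u
    root {x} x≢0 = begin
      x                            ≡⟨ *-identityʳ x ⟨
      x ^ 1                        ≡⟨ ^-periodic x≢0 1 v ⟨
      x ^ (1 ℕ.+ v ℕ.* (size ∸ 1)) ≡⟨ cong (x ^_) (trans 1+v[q-1]≡u[1+b] (ℕ.*-comm u (suc b))) ⟩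
      x ^ (suc b ℕ.* u)            ≡⟨ ^-* x (suc b) u ⟩
      (x ^ suc b) ^ u              ∎
  ...   | Bézout.-+ u v 1+u[1+b]≡v[q-1] =
    *-cancelʳ-≢0 (^-≢0 (^-≢0 s≢0 (suc b)) u)
                 (trans (unit s≢0) (sym (trans (cong (λ y → t * y ^ u) sᵇ≡tᵇ) (unit t≢0))))
    where
    unit : ∀ {x} → x ≢ 0# → x * (x ^ suc b) ^ u ≡ 1#
    unit {x} x≢0 = begin
      x * (x ^ suc b) ^ u          ≡⟨ cong (x *_) (^-* x (suc b) u) ⟨
      x ^ suc (suc b ℕ.* u)        ≡⟨ cong (x ^_) (trans (cong suc (ℕ.*-comm (suc b) u)) 1+u[1+b]≡v[q-1]) ⟩
      x ^ (0 ℕ.+ v ℕ.* (size ∸ 1)) ≡⟨ ^-periodic x≢0 0 v ⟩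
      1#                           ∎
      where open ≡-Reasoning

  sumFin-cong : ∀ {n} {g h : Fin n → Carrier} → (∀ j → g j ≡ h j) → sumFin F g ≡ sumFin F h
  sumFin-cong {zero}  g≗h = refl
  sumFin-cong {suc n} g≗h = cong₂ _+_ (g≗h zero) (sumFin-cong (g≗h ∘ suc))

  sumFin-exchange : ∀ {n} (g h : Fin n → Carrier) j → (∀ k → k ≢ j → g k ≡ h k) →
                    sumFin F g + h j ≡ sumFin F h + g j
  sumFin-exchange g h zero g≗h = begin
    g zero + sumFin F (g ∘ suc) + h zero
      ≡⟨ cong (λ s → g zero + s + h zero) (sumFin-cong (λ k → g≗h (suc k) λ ())) ⟩
    g zero + sumFin F (h ∘ suc) + h zero
      ≡⟨ xy∙z≈zy∙x (g zero) _ (h zero) ⟩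
    h zero + sumFin F (h ∘ suc) + g zero ∎
    where open ≡-Reasoning
  sumFin-exchange g h (suc j) g≗h = begin
    g zero + sumFin F (g ∘ suc) + h (suc j)
      ≡⟨ +-assoc (g zero) _ _ ⟩
    g zero + (sumFin F (g ∘ suc) + h (suc j))
      ≡⟨ cong₂ _+_ (g≗h zero λ ())
        (sumFin-exchange (g ∘ suc) (h ∘ suc) j (λ k k≢j → g≗h (suc k) (k≢j ∘ suc-injective))) ⟩
    h zero + (sumFin F (h ∘ suc) + g (suc j))
      ≡⟨ +-assoc (h zero) _ _ ⟨
    h zero + sumFin F (h ∘ suc) + g (suc j) ∎
    where open ≡-Reasoning

  fA-update : ∀ {n} (b : Fin n → ℕ) a x j t →
              fA F b a (x [ j ]≔ t) + lookup a (inject₁ j) * (lookup x j ^ b j)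
              ≡ fA F b a x + lookup a (inject₁ j) * (t ^ b j)
  fA-update {n} b a x j t = begin
    sumFin F h + c + g j
      ≡⟨ xy∙z≈xz∙y (sumFin F h) c (g j) ⟩
    sumFin F h + g j + c
      ≡⟨ cong (_+ c) (sumFin-exchange h g j unchanged) ⟩
    sumFin F g + h j + c
      ≡⟨ xy∙z≈xz∙y (sumFin F g) (h j) c ⟩
    sumFin F g + c + h j
      ≡⟨ cong (λ y → sumFin F g + c + lookup a (inject₁ j) * (y ^ b j)) (lookup∘update j x t) ⟩
    sumFin F g + c + lookup a (inject₁ j) * (t ^ b j) ∎
    where
    open ≡-Reasoning
    g h : Fin n → Carrier
    g k = lookup a (inject₁ k) * (lookup x k ^ b k)
    h k = lookup a (inject₁ k) * (lookup (x [ j ]≔ t) k ^ b k)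
    c = lookup a (fromℕ n)
    unchanged : ∀ k → k ≢ j → h k ≡ g k
    unchanged k k≢j = cong (λ y → lookup a (inject₁ k) * (y ^ b k)) (lookup∘update′ k≢j x t)

  -- Subtracting the β-equation from the α-equation leaves (α - β) u = (α - β) w.
  affine-cancel : ∀ {α β u w L L′ M M′} → α ≢ β → L ≡ M → L′ ≡ M′ →
                  L′ + α * u ≡ L + α * w → M′ + β * u ≡ M + β * w → u ≡ w
  affine-cancel {α} {β} {u} {w} {L} {L′} α≢β refl refl eqα eqβ =
    *-cancelʳ-≢0 (α≢β ∘ x∙y⁻¹≈ε⇒x≈y α β)
      (+-cancelʳ (L + β * w) (u * (α - β)) (w * (α - β)) (begin
      u * (α - β) + (L + β * w)  ≡⟨ cong (_+_ (u * (α - β))) eqβ ⟨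
      u * (α - β) + (L′ + β * u) ≡⟨ regroup L′ u ⟩
      L′ + (α - β + β) * u       ≡⟨ cong (λ a → L′ + a * u) (//-rightDividesˡ β α) ⟩
      L′ + α * u                 ≡⟨ eqα ⟩
      L + α * w                  ≡⟨ cong (λ a → L + a * w) (//-rightDividesˡ β α) ⟨
      L + (α - β + β) * w        ≡⟨ regroup L w ⟨
      w * (α - β) + (L + β * w)  ∎))
    where
    open ≡-Reasoning
    regroup : ∀ K v → v * (α - β) + (K + β * v) ≡ K + (α - β + β) * v
    regroup = solve 4 (λ δ β K v → (v ⊗ δ ⊕ (K ⊕ β ⊗ v)) ⊜ (K ⊕ (δ ⊕ β) ⊗ v)) refl (α - β) β

  fA-agreement-on-lines : ∀ {m} (b : Fin (suc m) → ℕ) → (∀ j {s t} → s ^ b j ≡ t ^ b j → s ≡ t) →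
                          ∀ {a a′} → a ≢ a′ → ∃ λ j → ∀ x t →
                          fA F b a x ≡ fA F b a′ x → fA F b a (x [ j ]≔ t) ≡ fA F b a′ (x [ j ]≔ t) →
                          t ≡ lookup x j
  fA-agreement-on-lines {m} b ^-injective {a} {a′} a≢a′
    with any? (λ k → ¬? (lookup a (inject₁ k) ≟ lookup a′ (inject₁ k)))
  ... | yes (j , aⱼ≢a′ⱼ) = j , λ x t agree agree′ →
          sym (^-injective j (affine-cancel aⱼ≢a′ⱼ agree agree′
                                            (fA-update b a x j t) (fA-update b a′ x j t)))
  ... | no ∄j = zero , λ x _ agree _ → contradiction (Pointwise-≡⇒≡ (ext (componentwise x agree))) a≢a′
    where
    same : ∀ k → lookup a (inject₁ k) ≡ lookup a′ (inject₁ k)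
    same k = decidable-stable (lookup a (inject₁ k) ≟ lookup a′ (inject₁ k))
                              (λ aₖ≢a′ₖ → ∄j (k , aₖ≢a′ₖ))
    componentwise : ∀ x → fA F b a x ≡ fA F b a′ x → ∀ i → lookup a i ≡ lookup a′ i
    componentwise x agree i with view i
    ... | ‵inject₁ k = same k
    ... | ‵fromℕ     = +-cancelˡ _ _ _ (trans (cong (_+ lookup a (fromℕ (suc m))) linear-parts) agree)
      where
      linear-parts : sumFin F (λ k → lookup a′ (inject₁ k) * (lookup x k ^ b k))
                     ≡ sumFin F (λ k → lookup a (inject₁ k) * (lookup x k ^ b k))
      linear-parts = sumFin-cong λ k → cong (_* (lookup x k ^ b k)) (sym (same k))

-- Points and graphs

module GraphIncidences {X Y : Set} (𝕏 : Enumerated X) (𝕐 : Enumerated Y) where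
  open import Data.Integer using (0ℤ; 1ℤ; _+_; _*_; _-_; -_; _≤_; +<+; positive)
  open import Data.Integer.Properties hiding (_≟_)
  open import Data.Integer.Tactic.RingSolver using (solve-∀)
  open import Data.List.Membership.Propositional.Properties using (∈-length)
  import Data.List.Membership.DecPropositional as DecMembership

  open Enumerated 𝕏 using () renaming (elements to Xs)
  open Enumerated 𝕐 using ()
    renaming (elements to Ys; unique to Ys-unique; complete to Ys-complete; _≟_ to _≟ʸ_)
  open Enumerated (×-enumerated 𝕏 𝕐) using () renaming (elements to XYs; _≟_ to _≟ᵖ_)
  open DecMembership _≟ᵖ_ using (_∈?_)

  N Q : ℤ
  N = + length Xs
  Q = + length Ys

  ∑-XYs : ∀ (f : X × Y → ℤ) → ∑ XYs f ≡ ∑[ x ∈ Xs ] ∑[ y ∈ Ys ] f (x , y)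
  ∑-XYs = ∑-cartesianProductWith _,_ Xs Ys

  agreements : (X → Y) → (X → Y) → ℤ
  agreements f g = ∑[ x ∈ Xs ] 𝟙 (f x ≟ʸ g x)

  agreements-self : ∀ f → agreements f f ≡ N
  agreements-self f = trans (∑-cong Xs (λ x → 𝟙-yes (f x ≟ʸ f x) refl)) (∑-one Xs)

  module _ {L : Set} (graph : L → X → Y) where

    incidence : L → X × Y → ℤ
    incidence v (x , y) = 𝟙 (graph v x ≟ʸ y)

    graph-incidences : List (X × Y) → List L → ℤ
    graph-incidences P V = ∑[ p ∈ P ] ∑[ v ∈ V ] incidence v p

    graph-meets-fibre : ∀ v x → ∑[ y ∈ Ys ] incidence v (x , y) ≡ 1ℤ
    graph-meets-fibre v x = trans (∑-𝟙≟ _≟ʸ_ Ys-unique (graph v x)) (𝟙-yes _ (Ys-complete (graph v x)))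

    ∑-incidence-pair : ∀ v w → ∑[ s ∈ XYs ] (incidence v s * incidence w s) ≡ agreements (graph w) (graph v)
    ∑-incidence-pair v w = trans (∑-XYs _) (∑-cong Xs λ x →
      ∑-𝟙≟-∈ _≟ʸ_ Ys-unique (Ys-complete (graph v x)) (λ y → 𝟙 (graph w x ≟ʸ y)))

    module _ (_≟ᴸ_ : DecidableEquality L) (M : ℤ)
             (few-agreements : ∀ {v w} → v ≢ w → agreements (graph v) (graph w) ≤ M)
             (V : List L) (V-unique : Unique V) where

      nV : ℤ
      nV = + length V

      graphs-through : X × Y → ℤ
      graphs-through s = ∑[ v ∈ V ] incidence v s

      graphs-excess : X × Y → ℤ
      graphs-excess s = Q * graphs-through s - nV

      ∑-graphs-through-fibre : ∀ x → ∑[ y ∈ Ys ] graphs-through (x , y) ≡ nV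
      ∑-graphs-through-fibre x = begin
        ∑[ y ∈ Ys ] ∑[ v ∈ V ] incidence v (x , y) ≡⟨ ∑-comm Ys V _ ⟩
        ∑[ v ∈ V ] ∑[ y ∈ Ys ] incidence v (x , y) ≡⟨ ∑-cong V (λ v → graph-meets-fibre v x) ⟩
        ∑[ v ∈ V ] 1ℤ                              ≡⟨ ∑-one V ⟩
        nV                                         ∎
        where open ≡-Reasoning

      ∑-graphs-excess-fibre : ∀ x → ∑[ y ∈ Ys ] graphs-excess (x , y) ≡ 0ℤ
      ∑-graphs-excess-fibre x = begin
        ∑[ y ∈ Ys ] (Q * graphs-through (x , y) - nV)
          ≡⟨ ∑-distrib-minus Ys _ _ ⟩
        ∑[ y ∈ Ys ] (Q * graphs-through (x , y)) - ∑[ _ ∈ Ys ] nV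
          ≡⟨ cong₂ _-_ (*-distribˡ-∑ Ys Q _) (sym (∑-const Ys nV)) ⟨
        Q * ∑[ y ∈ Ys ] graphs-through (x , y) - Q * nV
          ≡⟨ cong (λ t → Q * t - Q * nV) (∑-graphs-through-fibre x) ⟩
        Q * nV - Q * nV
          ≡⟨ +-inverseʳ (Q * nV) ⟩
        0ℤ ∎
        where open ≡-Reasoning

      ∑-graphs-through : ∑[ s ∈ XYs ] graphs-through s ≡ N * nV
      ∑-graphs-through = trans (∑-XYs _) (trans (∑-cong Xs ∑-graphs-through-fibre) (∑-const Xs nV))

      ∑-graphs-excess : ∑[ s ∈ XYs ] graphs-excess s ≡ 0ℤ
      ∑-graphs-excess = trans (∑-XYs _) (trans (∑-cong Xs ∑-graphs-excess-fibre) (∑-zero Xs))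

      ∑-graphs-through² : ∑[ s ∈ XYs ] (graphs-through s * graphs-through s)
                          ≡ ∑[ v ∈ V ] ∑[ w ∈ V ] agreements (graph w) (graph v)
      ∑-graphs-through² = begin
        ∑[ s ∈ XYs ] (graphs-through s * graphs-through s)
          ≡⟨ ∑-cong XYs (λ s → ∑-*-∑ V V _ _) ⟩
        ∑[ s ∈ XYs ] ∑[ v ∈ V ] ∑[ w ∈ V ] (incidence v s * incidence w s)
          ≡⟨ ∑-comm XYs V _ ⟩
        ∑[ v ∈ V ] ∑[ s ∈ XYs ] ∑[ w ∈ V ] (incidence v s * incidence w s)
          ≡⟨ ∑-cong V (λ v → ∑-comm XYs V _) ⟩
        ∑[ v ∈ V ] ∑[ w ∈ V ] ∑[ s ∈ XYs ] (incidence v s * incidence w s)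
          ≡⟨ ∑-cong V (λ v → ∑-cong V (∑-incidence-pair v)) ⟩
        ∑[ v ∈ V ] ∑[ w ∈ V ] agreements (graph w) (graph v) ∎
        where open ≡-Reasoning

      agreements-≤ : ∀ v w → agreements (graph w) (graph v) ≤ M + 𝟙 (v ≟ᴸ w) * (N - M)
      agreements-≤ v w with v ≟ᴸ w
      ... | yes refl = ≤-reflexive (trans (agreements-self (graph v)) (N≡M+1*[N-M] M N))
        where
        N≡M+1*[N-M] : ∀ M N → N ≡ M + 1ℤ * (N - M)
        N≡M+1*[N-M] = solve-∀
      ... | no v≢w  = ≤-trans (few-agreements (v≢w ∘ sym)) (≤-reflexive (M≡M+0*[N-M] M N))
        where
        M≡M+0*[N-M] : ∀ M N → M ≡ M + 0ℤ * (N - M)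
        M≡M+0*[N-M] = solve-∀

      ∑-agreements-≤ : ∀ {v} → v ∈ V → ∑[ w ∈ V ] agreements (graph w) (graph v) ≤ nV * M + (N - M)
      ∑-agreements-≤ {v} v∈V = begin
        ∑[ w ∈ V ] agreements (graph w) (graph v)
          ≤⟨ ∑-mono-≤ V (λ {w} _ → agreements-≤ v w) ⟩
        ∑[ w ∈ V ] (M + 𝟙 (v ≟ᴸ w) * (N - M))
          ≡⟨ ∑-distrib-+ V _ _ ⟩
        ∑[ _ ∈ V ] M + ∑[ w ∈ V ] (𝟙 (v ≟ᴸ w) * (N - M))
          ≡⟨ cong₂ _+_ (∑-const V M) (∑-𝟙≟-∈ _≟ᴸ_ V-unique v∈V (λ _ → N - M)) ⟩
        nV * M + (N - M) ∎
        where open ≤-Reasoning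

      ∑-graphs-through²-≤ : ∑[ s ∈ XYs ] (graphs-through s * graphs-through s) ≤ nV * (nV * M + (N - M))
      ∑-graphs-through²-≤ = begin
        ∑[ s ∈ XYs ] (graphs-through s * graphs-through s)     ≡⟨ ∑-graphs-through² ⟩
        ∑[ v ∈ V ] ∑[ w ∈ V ] agreements (graph w) (graph v)  ≤⟨ ∑-mono-≤ V ∑-agreements-≤ ⟩
        ∑[ _ ∈ V ] (nV * M + (N - M))                         ≡⟨ ∑-const V _ ⟩
        nV * (nV * M + (N - M))                               ∎
        where open ≤-Reasoning

      ∑-graphs-excess² : ∑[ s ∈ XYs ] (graphs-excess s * graphs-excess s)
                         ≡ Q * (Q * ∑[ s ∈ XYs ] (graphs-through s * graphs-through s) - nV * (N * nV))
      ∑-graphs-excess² = begin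
        ∑[ s ∈ XYs ] (z s * z s)                    ≡⟨ ∑-cong XYs (λ s → split Q (r s) nV) ⟩
        ∑[ s ∈ XYs ] (Q * (r s * z s) - nV * z s)   ≡⟨ ∑-linear XYs Q nV _ _ ⟩
        Q * ∑[ s ∈ XYs ] (r s * z s) - nV * ∑ XYs z ≡⟨ cong₂ (λ a b → Q * a - nV * b) ∑-rz ∑-graphs-excess ⟩
        Q * T - nV * 0ℤ                             ≡⟨ drop-zero (Q * T) nV ⟩
        Q * T                                       ∎
        where
        open ≡-Reasoning
        r z : X × Y → ℤ
        r = graphs-through
        z = graphs-excess
        T = Q * ∑[ s ∈ XYs ] (r s * r s) - nV * (N * nV)
        drop-zero : ∀ a n → a - n * 0ℤ ≡ a
        drop-zero = solve-∀
        split : ∀ Q r nV → (Q * r - nV) * (Q * r - nV) ≡ Q * (r * (Q * r - nV)) - nV * (Q * r - nV)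
        split = solve-∀
        expand : ∀ Q r nV → r * (Q * r - nV) ≡ Q * (r * r) - nV * r
        expand = solve-∀
        ∑-rz : ∑[ s ∈ XYs ] (r s * z s) ≡ T
        ∑-rz = trans (∑-cong XYs (λ s → expand Q (r s) nV))
                     (trans (∑-linear XYs Q nV _ _)
                            (cong (λ t → Q * ∑[ s ∈ XYs ] (r s * r s) - nV * t) ∑-graphs-through))

      ∑-graphs-excess²-≤ : ∑[ s ∈ XYs ] (graphs-excess s * graphs-excess s)
                           ≤ Q * nV * (N * (Q - nV) + Q * (nV - 1ℤ) * M)
      ∑-graphs-excess²-≤ = begin
        ∑[ s ∈ XYs ] (graphs-excess s * graphs-excess s)
          ≡⟨ ∑-graphs-excess² ⟩
        Q * (Q * ∑[ s ∈ XYs ] (graphs-through s * graphs-through s) - nV * (N * nV))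
          ≤⟨ *-monoˡ-≤-nonNeg Q (+-monoˡ-≤ (- (nV * (N * nV)))
                                           (*-monoˡ-≤-nonNeg Q ∑-graphs-through²-≤)) ⟩
        Q * (Q * (nV * (nV * M + (N - M))) - nV * (N * nV))
          ≡⟨ collect Q N M nV ⟩
        Q * nV * (N * (Q - nV) + Q * (nV - 1ℤ) * M) ∎
        where
        open ≤-Reasoning
        collect : ∀ Q N M nV → Q * (Q * (nV * (nV * M + (N - M))) - nV * (N * nV))
                               ≡ Q * nV * (N * (Q - nV) + Q * (nV - 1ℤ) * M)
        collect = solve-∀

      module _ (P : List (X × Y)) (P-unique : Unique P) where

        nP : ℤ
        nP = + length P

        in-P : X × Y → ℤ
        in-P s = 𝟙 (s ∈? P)

        P-above : X → ℤ
        P-above x = ∑[ y ∈ Ys ] in-P (x , y)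

        P-excess : X × Y → ℤ
        P-excess (x , y) = Q * in-P (x , y) - P-above x

        ∑-P-above : ∑[ x ∈ Xs ] P-above x ≡ nP
        ∑-P-above = begin
          ∑[ x ∈ Xs ] ∑[ y ∈ Ys ] in-P (x , y)  ≡⟨ ∑-XYs in-P ⟨
          ∑[ s ∈ XYs ] in-P s                   ≡⟨ ∑-cong XYs (λ s → *-identityʳ (in-P s)) ⟨
          ∑[ s ∈ XYs ] (in-P s * 1ℤ)            ≡⟨ ∑-𝟙∈? (×-enumerated 𝕏 𝕐) P-unique (λ _ → 1ℤ) ⟩
          ∑[ _ ∈ P ] 1ℤ                         ≡⟨ ∑-one P ⟩
          nP                                    ∎
          where open ≡-Reasoning

        ∑-P-excess²-fibre-≤ : ∀ x → ∑[ y ∈ Ys ] (P-excess (x , y) * P-excess (x , y))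
                                    ≤ Q * (Q - 1ℤ) * P-above x
        ∑-P-excess²-fibre-≤ x = begin
          ∑[ y ∈ Ys ] ((Q * μ y - φ) * (Q * μ y - φ))
            ≡⟨ ∑-cong Ys (λ y → trans (expand Q (μ y) φ)
                 (cong (λ m → Q * Q * m - + 2 * Q * φ * μ y + φ * φ) (𝟙-idem ((x , y) ∈? P)))) ⟩
          ∑[ y ∈ Ys ] (Q * Q * μ y - + 2 * Q * φ * μ y + φ * φ)
            ≡⟨ ∑-distrib-+ Ys _ _ ⟩
          ∑[ y ∈ Ys ] (Q * Q * μ y - + 2 * Q * φ * μ y) + ∑[ _ ∈ Ys ] (φ * φ)
            ≡⟨ cong₂ _+_ (∑-linear Ys (Q * Q) (+ 2 * Q * φ) μ μ) (∑-const Ys (φ * φ)) ⟩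
          Q * Q * φ - + 2 * Q * φ * φ + Q * (φ * φ)
            ≤⟨ 0≤i-j⇒j≤i (subst (0ℤ ≤_) (slack Q φ)
                 (≤-trans (≤-reflexive (sym (*-zeroʳ Q))) (*-monoˡ-≤-nonNeg Q (k*[k-1]-nonNeg φ)))) ⟩
          Q * (Q - 1ℤ) * φ ∎
          where
          open ≤-Reasoning
          μ : Y → ℤ
          μ y = in-P (x , y)
          φ = P-above x
          expand : ∀ Q m φ → (Q * m - φ) * (Q * m - φ) ≡ Q * Q * (m * m) - + 2 * Q * φ * m + φ * φ
          expand = solve-∀
          slack : ∀ Q φ → Q * (φ * (φ - 1ℤ))
                          ≡ Q * (Q - 1ℤ) * φ - (Q * Q * φ - + 2 * Q * φ * φ + Q * (φ * φ))
          slack = solve-∀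

        ∑-P-excess²-≤ : ∑[ s ∈ XYs ] (P-excess s * P-excess s) ≤ Q * (Q - 1ℤ) * nP
        ∑-P-excess²-≤ = begin
          ∑[ s ∈ XYs ] (P-excess s * P-excess s)
            ≡⟨ ∑-XYs _ ⟩
          ∑[ x ∈ Xs ] ∑[ y ∈ Ys ] (P-excess (x , y) * P-excess (x , y))
            ≤⟨ ∑-mono-≤ Xs (λ {x} _ → ∑-P-excess²-fibre-≤ x) ⟩
          ∑[ x ∈ Xs ] (Q * (Q - 1ℤ) * P-above x)
            ≡⟨ *-distribˡ-∑ Xs (Q * (Q - 1ℤ)) P-above ⟨
          Q * (Q - 1ℤ) * ∑[ x ∈ Xs ] P-above x
            ≡⟨ cong (Q * (Q - 1ℤ) *_) ∑-P-above ⟩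
          Q * (Q - 1ℤ) * nP ∎
          where open ≤-Reasoning

        ∑-excess-product : ∑[ s ∈ XYs ] (P-excess s * graphs-excess s)
                           ≡ Q * (Q * graph-incidences P V - nP * nV)
        ∑-excess-product = begin
          ∑[ s ∈ XYs ] (P-excess s * graphs-excess s)
            ≡⟨ ∑-cong XYs (λ (x , y) →
                 *-distribʳ-minus (graphs-excess (x , y)) (Q * in-P (x , y)) (P-above x)) ⟩
          ∑[ s ∈ XYs ] (Q * in-P s * graphs-excess s - P-above (proj₁ s) * graphs-excess s)
            ≡⟨ ∑-distrib-minus XYs _ _ ⟩
          ∑[ s ∈ XYs ] (Q * in-P s * graphs-excess s) - ∑[ s ∈ XYs ] (P-above (proj₁ s) * graphs-excess s)
            ≡⟨ cong₂ _-_ on-P off-P ⟩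
          Q * (Q * graph-incidences P V - nP * nV) - 0ℤ
            ≡⟨ +-identityʳ _ ⟩
          Q * (Q * graph-incidences P V - nP * nV) ∎
          where
          open ≡-Reasoning
          *-distribʳ-minus : ∀ c a b → (a - b) * c ≡ a * c - b * c
          *-distribʳ-minus = solve-∀
          on-P : ∑[ s ∈ XYs ] (Q * in-P s * graphs-excess s) ≡ Q * (Q * graph-incidences P V - nP * nV)
          on-P = begin
            ∑[ s ∈ XYs ] (Q * in-P s * graphs-excess s)
              ≡⟨ ∑-cong XYs (λ s → *-assoc Q (in-P s) _) ⟩
            ∑[ s ∈ XYs ] (Q * (in-P s * graphs-excess s))
              ≡⟨ *-distribˡ-∑ XYs Q _ ⟨
            Q * ∑[ s ∈ XYs ] (in-P s * graphs-excess s)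
              ≡⟨ cong (Q *_) (∑-𝟙∈? (×-enumerated 𝕏 𝕐) P-unique graphs-excess) ⟩
            Q * ∑[ p ∈ P ] (Q * graphs-through p - nV)
              ≡⟨ cong (Q *_) (∑-distrib-minus P _ _) ⟩
            Q * (∑[ p ∈ P ] (Q * graphs-through p) - ∑[ _ ∈ P ] nV)
              ≡⟨ cong (Q *_) (cong₂ _-_ (*-distribˡ-∑ P Q graphs-through) (sym (∑-const P nV))) ⟨
            Q * (Q * graph-incidences P V - nP * nV) ∎
          off-P : ∑[ s ∈ XYs ] (P-above (proj₁ s) * graphs-excess s) ≡ 0ℤ
          off-P = begin
            ∑[ s ∈ XYs ] (P-above (proj₁ s) * graphs-excess s)
              ≡⟨ ∑-XYs _ ⟩
            ∑[ x ∈ Xs ] ∑[ y ∈ Ys ] (P-above x * graphs-excess (x , y))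
              ≡⟨ ∑-cong Xs (λ x → *-distribˡ-∑ Ys (P-above x) _) ⟨
            ∑[ x ∈ Xs ] (P-above x * ∑[ y ∈ Ys ] graphs-excess (x , y))
              ≡⟨ ∑-cong Xs (λ x → cong (P-above x *_) (∑-graphs-excess-fibre x)) ⟩
            ∑[ x ∈ Xs ] (P-above x * 0ℤ)
              ≡⟨ ∑-cong Xs (λ x → *-zeroʳ (P-above x)) ⟩
            ∑[ _ ∈ Xs ] 0ℤ
              ≡⟨ ∑-zero Xs ⟩
            0ℤ ∎

        scaled-bound : Q * (Q * ((Q * graph-incidences P V - nP * nV) * (Q * graph-incidences P V - nP * nV)))
                       ≤ Q * (Q * ((Q - 1ℤ) * nP * nV * (N * (Q - nV) + Q * (nV - 1ℤ) * M)))
        scaled-bound = begin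
          Q * (Q * (D * D))
            ≡⟨ square-scaled Q D ⟩
          Q * D * (Q * D)
            ≡⟨ cong₂ _*_ ∑-excess-product ∑-excess-product ⟨
          ∑[ s ∈ XYs ] (P-excess s * graphs-excess s) * ∑[ s ∈ XYs ] (P-excess s * graphs-excess s)
            ≤⟨ cauchy-schwarz XYs P-excess graphs-excess ⟩
          ∑[ s ∈ XYs ] (P-excess s * P-excess s) * ∑[ s ∈ XYs ] (graphs-excess s * graphs-excess s)
            ≤⟨ *-mono-≤-nonNeg (∑-nonNeg XYs (λ s → square-nonNeg (P-excess s)))
                               (∑-nonNeg XYs (λ s → square-nonNeg (graphs-excess s)))
                               ∑-P-excess²-≤ ∑-graphs-excess²-≤ ⟩
          Q * (Q - 1ℤ) * nP * (Q * nV * K)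
            ≡⟨ regroup Q nP nV K ⟩
          Q * (Q * ((Q - 1ℤ) * nP * nV * K)) ∎
          where
          open ≤-Reasoning
          D = Q * graph-incidences P V - nP * nV
          K = N * (Q - nV) + Q * (nV - 1ℤ) * M
          square-scaled : ∀ Q D → Q * (Q * (D * D)) ≡ Q * D * (Q * D)
          square-scaled = solve-∀
          regroup : ∀ Q nP nV K → Q * (Q - 1ℤ) * nP * (Q * nV * K) ≡ Q * (Q * ((Q - 1ℤ) * nP * nV * K))
          regroup = solve-∀

      -- Cancelling Q² needs Y to be inhabited, which a point of P witnesses.
      incidence-bound : ∀ P → Unique P →
                        (Q * graph-incidences P V - + length P * nV) * (Q * graph-incidences P V - + length P * nV)
                        ≤ (Q - 1ℤ) * + length P * nV * (N * (Q - nV) + Q * (nV - 1ℤ) * M)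
      incidence-bound [] _ = ≤-reflexive (no-points Q nV (N * (Q - nV) + Q * (nV - 1ℤ) * M))
        where
        no-points : ∀ Q nV K → (Q * 0ℤ - 0ℤ * nV) * (Q * 0ℤ - 0ℤ * nV) ≡ (Q - 1ℤ) * 0ℤ * nV * K
        no-points = solve-∀
      incidence-bound P@((_ , y) ∷ _) P-unique =
        *-cancelˡ-≤-pos _ _ Q {{Q-positive}} (*-cancelˡ-≤-pos _ _ Q {{Q-positive}} (scaled-bound P P-unique))
        where
        Q-positive = positive (+<+ (∈-length (Ys-complete y)))

-- The varieties V_a

module Varieties (F : FiniteField) {m d : ℕ} (h : Fin d → Poly F (suc m)) (b : Fin d → Fin (suc m) → ℕ)
                 (b-injective : ∀ i j {s t} → FiniteField._^_ F s (b i j) ≡ FiniteField._^_ F t (b i j) → s ≡ t)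
                 where
  open FiniteField F using (Carrier; _≟_; size; _+_)
  open FiniteFieldProperties F using (commutativeRing; fA-agreement-on-lines)
  open import Algebra.Bundles using (CommutativeRing)
  open import Algebra.Properties.Ring (CommutativeRing.ring commutativeRing) using (+-cancelˡ)
  open import Data.Integer using (1ℤ; _*_; _-_; _≤_)
  open import Data.Integer.Properties using (pos-*)
  open import Data.Bool using (if_then_else_)
  open import Data.Fin using (_↑ˡ_; _↑ʳ_; join; splitAt)
  open import Data.Fin.Properties using (join-splitAt; ¬∀⟶∃¬)
  open import Data.Nat.ListAction using (sum)
  open import Data.List.Properties using (length-map)
  import Data.List.Relation.Unary.Unique.Propositional.Properties as Unique
  open import Data.Sum using (inj₁; inj₂)
  open import Data.Vec.Properties using (lookup∘tabulate)
  import Data.Vec.Properties as Vec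
  open import Data.Vec.Relation.Binary.Pointwise.Extensional using (ext; Pointwise-≡⇒≡)
  open import Relation.Nullary.Decidable using (isYes)

  𝔽 : Enumerated Carrier
  𝔽 = field-enumerated F

  open GraphIncidences (Vec-enumerated 𝔽 (suc m)) (Vec-enumerated 𝔽 d)

  Parameters : Set
  Parameters = Vec (Vec Carrier (suc (suc m))) d

  variety : Parameters → Vec Carrier (suc m) → Vec Carrier d
  variety as x = tabulate (λ i → eval F (h i) x + fA F (b i) (lookup as i) x)

  fA-agree : ∀ {as as′} x i → variety as x ≡ variety as′ x →
             fA F (b i) (lookup as i) x ≡ fA F (b i) (lookup as′ i) x
  fA-agree {as} {as′} x i eq = +-cancelˡ (eval F (h i) x) _ _ (begin
    eval F (h i) x + fA F (b i) (lookup as i) x  ≡⟨ lookup∘tabulate _ i ⟨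
    lookup (variety as x) i                      ≡⟨ cong (λ v → lookup v i) eq ⟩
    lookup (variety as′ x) i                     ≡⟨ lookup∘tabulate _ i ⟩
    eval F (h i) x + fA F (b i) (lookup as′ i) x ∎)
    where open ≡-Reasoning

  few-agreements : ∀ {as as′} → as ≢ as′ → agreements (variety as) (variety as′) ≤ + (size ℕ.^ m)
  few-agreements {as} {as′} as≢as′
    with ¬∀⟶∃¬ d _ (λ i → Vec.≡-dec _≟_ (lookup as i) (lookup as′ i))
                   (as≢as′ ∘ Pointwise-≡⇒≡ ∘ ext)
  ... | i , asᵢ≢as′ᵢ with fA-agreement-on-lines (b i) (b-injective i) asᵢ≢as′ᵢ
  ...   | j , on-lines =
    line-count 𝔽 j (λ x → Vec.≡-dec _≟_ (variety as x) (variety as′ x)) λ x t eq eq′ →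
      on-lines x t (fA-agree {as} {as′} x i eq) (fA-agree {as} {as′} (x [ j ]≔ t) i eq′)

  lastN : Vec Carrier (suc m ℕ.+ d) → Vec Carrier d
  lastN p = tabulate (λ i → lookup p (suc m ↑ʳ i))

  split : Vec Carrier (suc m ℕ.+ d) → Vec Carrier (suc m) × Vec Carrier d
  split p = firstN F p , lastN p

  split-injective : ∀ {p p′} → split p ≡ split p′ → p ≡ p′
  split-injective {p} {p′} eq = Pointwise-≡⇒≡ (ext λ i →
    subst (λ k → lookup p k ≡ lookup p′ k) (join-splitAt (suc m) d i) (by-part (splitAt (suc m) i)))
    where
    open ≡-Reasoning
    by-part : ∀ k → lookup p (join (suc m) d k) ≡ lookup p′ (join (suc m) d k)
    by-part (inj₁ k) = begin
      lookup p (k ↑ˡ d)      ≡⟨ lookup∘tabulate (λ j → lookup p (j ↑ˡ d)) k ⟨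
      lookup (firstN F p) k  ≡⟨ cong (λ x → lookup (proj₁ x) k) eq ⟩
      lookup (firstN F p′) k ≡⟨ lookup∘tabulate (λ j → lookup p′ (j ↑ˡ d)) k ⟩
      lookup p′ (k ↑ˡ d)     ∎
    by-part (inj₂ k) = begin
      lookup p (suc m ↑ʳ k)  ≡⟨ lookup∘tabulate (λ j → lookup p (suc m ↑ʳ j)) k ⟨
      lookup (lastN p) k     ≡⟨ cong (λ x → lookup (proj₂ x) k) eq ⟩
      lookup (lastN p′) k    ≡⟨ lookup∘tabulate (λ j → lookup p′ (suc m ↑ʳ j)) k ⟩
      lookup p′ (suc m ↑ʳ k) ∎

  in-variety : ∀ p as → InVariety F h b p as → variety as (firstN F p) ≡ lastN p
  in-variety p as p∈V = Pointwise-≡⇒≡ (ext λ i → begin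
    lookup (variety as (firstN F p)) i
      ≡⟨ lookup∘tabulate _ i ⟩
    eval F (h i) (firstN F p) + fA F (b i) (lookup as i) (firstN F p)
      ≡⟨ p∈V i ⟨
    lookup p (suc m ↑ʳ i)
      ≡⟨ lookup∘tabulate (λ j → lookup p (suc m ↑ʳ j)) i ⟨
    lookup (lastN p) i ∎)
    where open ≡-Reasoning

  on-variety : ∀ p as → variety as (firstN F p) ≡ lastN p → InVariety F h b p as
  on-variety p as eq i = begin
    lookup p (suc m ↑ʳ i)
      ≡⟨ lookup∘tabulate (λ j → lookup p (suc m ↑ʳ j)) i ⟨
    lookup (lastN p) i
      ≡⟨ cong (λ v → lookup v i) eq ⟨
    lookup (variety as (firstN F p)) i
      ≡⟨ lookup∘tabulate _ i ⟩
    eval F (h i) (firstN F p) + fA F (b i) (lookup as i) (firstN F p) ∎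
    where open ≡-Reasoning

  incidences≡ : ∀ P 𝒱 → + incidences F h b P 𝒱 ≡ graph-incidences variety (map split P) 𝒱
  incidences≡ P 𝒱 = begin
    + incidences F h b P 𝒱
      ≡⟨ +-sum P _ ⟩
    ∑[ p ∈ P ] (+ sum (map (λ as → if isYes (inVariety? F h b p as) then 1 else 0) 𝒱))
      ≡⟨ ∑-cong P (λ p → +-sum 𝒱 _) ⟩
    ∑[ p ∈ P ] ∑[ as ∈ 𝒱 ] 𝟙 (inVariety? F h b p as)
      ≡⟨ ∑-cong P (λ p → ∑-cong 𝒱 (λ as → 𝟙-cong _ _ (in-variety p as) (on-variety p as))) ⟩
    ∑[ p ∈ P ] ∑[ as ∈ 𝒱 ] incidence variety as (split p)
      ≡⟨ ∑-map split P _ ⟨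
    graph-incidences variety (map split P) 𝒱 ∎
    where open ≡-Reasoning

  -- Stated for any qᵈ = q^d, so that the case d = 1 can use q itself.
  variety-bound : ∀ {qᵈ} → size ℕ.^ d ≡ qᵈ → ∀ P → Unique P → ∀ 𝒱 → Unique 𝒱 →
                  let D  = + (qᵈ ℕ.* incidences F h b P 𝒱) - + (length P ℕ.* length 𝒱)
                      nP = + length P
                      nV = + length 𝒱
                      qᵐ = + (size ℕ.^ m)
                  in D * D ≤ (+ qᵈ - 1ℤ) * nP * nV
                             * (+ size * qᵐ * (+ qᵈ - nV) ℤ.+ + qᵈ * (nV - 1ℤ) * qᵐ)
  variety-bound {qᵈ} sizeᵈ≡qᵈ P P-unique 𝒱 𝒱-unique =
    transport Q≡ N≡ nP≡ D≡
      (incidence-bound variety (Vec.≡-dec (Vec.≡-dec _≟_)) (+ (size ℕ.^ m)) few-agreements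
                       𝒱 𝒱-unique (map split P) (Unique.map⁺ split-injective P-unique))
    where
    transport : ∀ {Q′ N′ nP′ D′ Q N nP D nV M : ℤ} →
                Q′ ≡ Q → N′ ≡ N → nP′ ≡ nP → D′ ≡ D →
                D′ * D′ ≤ (Q′ - 1ℤ) * nP′ * nV * (N′ * (Q′ - nV) ℤ.+ Q′ * (nV - 1ℤ) * M) →
                D * D ≤ (Q - 1ℤ) * nP * nV * (N * (Q - nV) ℤ.+ Q * (nV - 1ℤ) * M)
    transport refl refl refl refl bound = bound
    Q≡ : Q ≡ + qᵈ
    Q≡ = cong +_ (trans (length-vectors 𝔽 d) sizeᵈ≡qᵈ)
    N≡ : N ≡ + size * + (size ℕ.^ m)
    N≡ = trans (cong +_ (length-vectors 𝔽 (suc m))) (pos-* size (size ℕ.^ m))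
    nP≡ : + length (map split P) ≡ + length P
    nP≡ = cong +_ (length-map split P)
    D≡ : Q * graph-incidences variety (map split P) 𝒱 - + length (map split P) * + length 𝒱
         ≡ + (qᵈ ℕ.* incidences F h b P 𝒱) - + (length P ℕ.* length 𝒱)
    D≡ = cong₂ _-_ (trans (cong₂ _*_ Q≡ (sym (incidences≡ P 𝒱))) (sym (pos-* qᵈ _)))
                   (trans (cong (_* + length 𝒱) nP≡) (sym (pos-* (length P) (length 𝒱))))

module _ where
  open import Data.Integer using (0ℤ; 1ℤ; _+_; _*_; _-_; _≤_; +≤+; nonNegative)
  open import Data.Integer.Properties hiding (_≟_)
  open import Data.Integer.Tactic.RingSolver using (solve-∀)
  import Data.Nat.Properties as ℕ

  pos-*-cong : ∀ a b {i j} → + a ≡ i → + b ≡ j → + (a ℕ.* b) ≡ i * j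
  pos-*-cong a b +a≡i +b≡j = trans (pos-* a b) (cong₂ _*_ +a≡i +b≡j)

  bound-d≡1 : ∀ q qᵐ nP nV D → 1 ℕ.≤ q →
              D * D ≤ (+ q - 1ℤ) * + nP * + nV * (+ q * + qᵐ * (+ q - + nV) + + q * (+ nV - 1ℤ) * + qᵐ) →
              D * D ≤ + (q ℕ.* qᵐ ℕ.* ((q ∸ 1) ℕ.* (q ∸ 1)) ℕ.* nP ℕ.* nV)
  bound-d≡1 q qᵐ nP nV D q≥1 bound = begin
    D * D
      ≤⟨ bound ⟩
    (+ q - 1ℤ) * + nP * + nV * (+ q * + qᵐ * (+ q - + nV) + + q * (+ nV - 1ℤ) * + qᵐ)
      ≡⟨ collect (+ q) (+ qᵐ) (+ nP) (+ nV) ⟩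
    + q * + qᵐ * ((+ q - 1ℤ) * (+ q - 1ℤ)) * + nP * + nV
      ≡⟨ cast ⟨
    + (q ℕ.* qᵐ ℕ.* ((q ∸ 1) ℕ.* (q ∸ 1)) ℕ.* nP ℕ.* nV) ∎
    where
    open ≤-Reasoning
    collect : ∀ q qᵐ nP nV → (q - 1ℤ) * nP * nV * (q * qᵐ * (q - nV) + q * (nV - 1ℤ) * qᵐ)
                              ≡ q * qᵐ * ((q - 1ℤ) * (q - 1ℤ)) * nP * nV
    collect = solve-∀
    q∸1≡ : + (q ∸ 1) ≡ + q - 1ℤ
    q∸1≡ = sym (trans (m-n≡m⊖n q 1) (⊖-≥ q≥1))
    w = (q ∸ 1) ℕ.* (q ∸ 1)
    cast : + (q ℕ.* qᵐ ℕ.* w ℕ.* nP ℕ.* nV) ≡ + q * + qᵐ * ((+ q - 1ℤ) * (+ q - 1ℤ)) * + nP * + nV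
    cast = pos-*-cong (q ℕ.* qᵐ ℕ.* w ℕ.* nP) nV
             (pos-*-cong (q ℕ.* qᵐ ℕ.* w) nP (pos-*-cong (q ℕ.* qᵐ) w
             (pos-* q qᵐ) (pos-*-cong (q ∸ 1) (q ∸ 1) q∸1≡ q∸1≡)) refl) refl

  bound-d≥1 : ∀ q m d nP nV D → 1 ℕ.≤ q →
              let Q = + (q ℕ.^ d); qᵐ = + (q ℕ.^ m)
              in D * D ≤ (Q - 1ℤ) * + nP * + nV * (+ q * qᵐ * (Q - + nV) + Q * (+ nV - 1ℤ) * qᵐ) →
                 D * D * + q ≤ + (q ℕ.^ (suc m ℕ.+ 2 ℕ.* d) ℕ.* nP ℕ.* nV ℕ.* (q ℕ.+ nV))
  bound-d≥1 q m d nP nV D q≥1 bound = begin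
    D * D * + q                                    ≤⟨ *-monoʳ-≤-nonNeg (+ q) bound ⟩
    R * + q                                        ≤⟨ i≤i+j (R * + q) slack {{nonNegative 0≤slack}} ⟩
    R * + q + slack                                ≡⟨ collect (+ q) Q qᵐ (+ nP) (+ nV) ⟩
    + q * qᵐ * Q * Q * + nP * + nV * (+ q + + nV)  ≡⟨ cast ⟨
    + (q ℕ.^ (suc m ℕ.+ 2 ℕ.* d) ℕ.* nP ℕ.* nV ℕ.* (q ℕ.+ nV)) ∎
    where
    open ≤-Reasoning
    Q qᵐ R slack : ℤ
    Q     = + (q ℕ.^ d)
    qᵐ    = + (q ℕ.^ m)
    R     = (Q - 1ℤ) * + nP * + nV * (+ q * qᵐ * (Q - + nV) + Q * (+ nV - 1ℤ) * qᵐ)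
    slack = + q * + nP * + nV * qᵐ * (Q * Q + Q * (+ q - 1ℤ) + + nV * (+ q * (Q - 1ℤ) + Q))
    0≤+ : ∀ n → 0ℤ ≤ + n
    0≤+ n = +≤+ ℕ.z≤n
    1≤Q : 1ℤ ≤ Q
    1≤Q = +≤+ (ℕ.m^n>0 q {{ℕ.>-nonZero q≥1}} d)
    0≤slack : 0ℤ ≤ slack
    0≤slack = *-nonNeg (*-nonNeg (*-nonNeg (*-nonNeg (0≤+ q) (0≤+ nP)) (0≤+ nV)) (0≤+ (q ℕ.^ m)))
                (+-mono-≤ (+-mono-≤ (square-nonNeg Q) (*-nonNeg (0≤+ (q ℕ.^ d)) (i≤j⇒0≤j-i (+≤+ q≥1))))
                          (*-nonNeg (0≤+ nV) (+-mono-≤ (*-nonNeg (0≤+ q) (i≤j⇒0≤j-i 1≤Q)) (0≤+ (q ℕ.^ d)))))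
    collect : ∀ q Q qᵐ nP nV →
              (Q - 1ℤ) * nP * nV * (q * qᵐ * (Q - nV) + Q * (nV - 1ℤ) * qᵐ) * q
              + q * nP * nV * qᵐ * (Q * Q + Q * (q - 1ℤ) + nV * (q * (Q - 1ℤ) + Q))
              ≡ q * qᵐ * Q * Q * nP * nV * (q + nV)
    collect = solve-∀
    qⁿ⁺²ᵈ = q ℕ.* q ℕ.^ m ℕ.* q ℕ.^ d ℕ.* q ℕ.^ d
    exponent : q ℕ.^ (suc m ℕ.+ 2 ℕ.* d) ≡ qⁿ⁺²ᵈ
    exponent = trans (ℕ.^-distribˡ-+-* q (suc m) (2 ℕ.* d))
      (trans (cong (q ℕ.^ suc m ℕ.*_) (trans (ℕ.^-distribˡ-+-* q d (d ℕ.+ 0))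
                                             (cong (λ e → q ℕ.^ d ℕ.* q ℕ.^ e) (ℕ.+-identityʳ d))))
             (sym (ℕ.*-assoc (q ℕ.^ suc m) (q ℕ.^ d) (q ℕ.^ d))))
    cast : + (q ℕ.^ (suc m ℕ.+ 2 ℕ.* d) ℕ.* nP ℕ.* nV ℕ.* (q ℕ.+ nV))
           ≡ + q * qᵐ * Q * Q * + nP * + nV * (+ q + + nV)
    cast = trans (cong (λ e → + (e ℕ.* nP ℕ.* nV ℕ.* (q ℕ.+ nV))) exponent)
      (pos-*-cong (qⁿ⁺²ᵈ ℕ.* nP ℕ.* nV) (q ℕ.+ nV)
        (pos-*-cong (qⁿ⁺²ᵈ ℕ.* nP) nV (pos-*-cong qⁿ⁺²ᵈ nP (pos-*-cong (q ℕ.* q ℕ.^ m ℕ.* q ℕ.^ d) (q ℕ.^ d)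
          (pos-*-cong (q ℕ.* q ℕ.^ m) (q ℕ.^ d) (pos-* q (q ℕ.^ m)) refl) refl) refl) refl)
        (pos-+ q nV))

open import Data.Nat using (_≤_)
open import Data.Nat.Properties using (*-identityʳ)
open import Data.List.Membership.Propositional.Properties using (∈-length)

theorem1p4 : (F : FiniteField) (n d : ℕ) → 1 ≤ n → 1 ≤ d
  → (h : Fin d → Poly F n) → (∀ i → DegLe F (FiniteField.size F ∸ 1) (h i))
  → (b : Fin d → Fin n → ℕ) → (∀ i j → 1 ≤ b i j)
  → (∀ i j → Coprime (b i j) (FiniteField.size F ∸ 1))
  → (P : List (Vec (FiniteField.Carrier F) (n ℕ.+ d))) → Unique P
  → (𝒱 : List (Vec (Vec (FiniteField.Carrier F) (suc n)) d)) → Unique 𝒱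
  → let q = FiniteField.size F
        I = incidences F h b P 𝒱
        nP = length P
        nV = length 𝒱
    in (2 ≤ d → (+ (q ℕ.^ d ℕ.* I) ℤ.- + (nP ℕ.* nV)) ℤ.* (+ (q ℕ.^ d ℕ.* I) ℤ.- + (nP ℕ.* nV)) ℤ.* + q
                  ℤ.≤ + (q ℕ.^ (n ℕ.+ 2 ℕ.* d) ℕ.* nP ℕ.* nV ℕ.* (q ℕ.+ nV)))
     × (d ≡ 1 → (+ (q ℕ.* I) ℤ.- + (nP ℕ.* nV)) ℤ.* (+ (q ℕ.* I) ℤ.- + (nP ℕ.* nV))
                  ℤ.≤ + (q ℕ.^ n ℕ.* ((q ∸ 1) ℕ.* (q ∸ 1)) ℕ.* nP ℕ.* nV))
theorem1p4 F zero    d ()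
theorem1p4 F (suc m) d _ _ h _ b b≥1 b-coprime P P-unique 𝒱 𝒱-unique =
    (λ _ → bound-d≥1 q m d nP nV (D (q ℕ.^ d)) q≥1 (variety-bound refl P P-unique 𝒱 𝒱-unique))
  , λ { refl → bound-d≡1 q (q ℕ.^ m) nP nV (D q) q≥1
                 (variety-bound (*-identityʳ q) P P-unique 𝒱 𝒱-unique) }
  where
  open FiniteField F using (elements-complete; 0#) renaming (size to q)
  open FiniteFieldProperties F using (^-injective)
  open Varieties F h b (λ i j → ^-injective (b≥1 i j) (b-coprime i j))
  nP nV : ℕ
  nP = length P
  nV = length 𝒱
  D : ℕ → ℤ
  D qᵈ = + (qᵈ ℕ.* incidences F h b P 𝒱) ℤ.- + (nP ℕ.* nV)
  q≥1 : 1 ≤ q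
  q≥1 = ∈-length (elements-complete 0#)
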